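{- Let $\boldsymbol{\alpha}=(\alpha_1,\ldots,\alpha_r)$ be a sequence of stack partitions and $n=\sum_{i=1}^r|\alpha_i|$. Then \[ \prod_{i=1}^r M_{\alpha_i} = \sum_{\tau\Vdash n}\mathcal{S}^{\tau}_{\boldsymbol{\alpha}}\, M_\tau . \]
   Context: Polysymmetric functions are formal power series of bounded degree in variables $x_{i,j}$ ($i,j\ge1$), $x_{i,j}$ of degree $i$, invariant under permutations of $x_{i,1},x_{i,2},\dots$ for each fixed $i$. A stack is a pair of positive integers $d^m$ (degree $d$, multiplicity $m$); a stack partition $\tau\Vdash n$ (with $|\tau|=n$) is a finite weakly decreasing sequence of stacks $(d_1^{m_1},\dots,d_s^{m_s})$ (ordered by $d^m\ge d'^{m'}$ iff $d>d'$, or $d=d'$ and $m\ge m'$) with $\sum d_im_i=n$. The monomial polysymmetric function is $M_\tau=\sum_\alpha x_{d_1,\alpha_1}^{m_1}\cdots x_{d_s,\alpha_s}^{m_s}$ over sequences $\alpha$ of positive integers with $\alpha_i\neq\alpha_j$ whenever $d_i=d_j$, $i\ne j$. For a positive integer $u$, $\tau|_u$ is the (weakly decreasing) sequence of multiplicities of the stacks of degree $u$ in $\tau$, and $\ell(\tau|_u)$ its length. For $\boldsymbol\alpha=(\alpha_1,\dots,\alpha_r)$ and $\tau$, let $s^\tau_{\boldsymbol\alpha}(u)$ be the number of $r\times\ell(\tau|_u)$ matrices with nonnegative integer entries whose $i$th row is a rearrangement of $\alpha_i|_u$ padded with zeros to length $\ell(\tau|_u)$, and whose sequence of column sums equals $\tau|_u$;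 if $\ell(\alpha_i|_u)>\ell(\tau|_u)$ for some $i$ then $s^\tau_{\boldsymbol\alpha}(u)=0$ (when $\ell(\tau|_u)=0$ and all $\alpha_i|_u$ are empty, the count is $1$). Set $\mathcal{S}^\tau_{\boldsymbol\alpha}=\prod_{u\ge1}s^\tau_{\boldsymbol\alpha}(u)$. -}

module Defs where

open import Data.Nat using (ℕ; zero; suc; _+_; _*_; _∸_; _≤_; _<_; _≟_; _≤?_; _<?_)
open import Data.Product using (_×_; _,_; proj₁; proj₂)
open import Data.Sum using (_⊎_)
open import Data.Bool using (if_then_else_)
open import Data.List using (List; []; _∷_; [_]; map; filter; length; foldr; concatMap;
  applyUpTo; replicate; _++_; deduplicate; cartesianProductWith; cartesianProduct; lookup; zipWith; allFin)
open import Data.List.Properties using (≡-dec)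
open import Data.Nat.ListAction using (sum; product)
open import Data.List.Relation.Unary.All using (All; all?)
open import Data.List.Relation.Unary.Linked using (Linked; linked?)
open import Data.Fin using (Fin)
import Data.Fin as F
open import Data.Fin.Properties as FP using ()
open import Data.Vec as V using (Vec)
open import Relation.Nullary using (Dec; ¬_; does)
open import Relation.Nullary.Decidable using (_×-dec_; _⊎-dec_; ¬?; _→-dec_)
open import Relation.Binary.PropositionalEquality using (_≡_; _≢_)
open import Algebra.Bundles using (CommutativeSemiring)

-- A stack d^m is the pair (d , m): degree d, multiplicity m.
Stack : Set
Stack = ℕ × ℕ

deg : Stack → ℕ
deg = proj₁

mult : Stack → ℕ
mult = proj₂

_≥ₛ_ : Stack → Stack → Set
s ≥ₛ t = (deg t < deg s) ⊎ (deg s ≡ deg t × mult t ≤ mult s)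

_≥ₛ?_ : (s t : Stack) → Dec (s ≥ₛ t)
s ≥ₛ? t = (deg t <? deg s) ⊎-dec ((deg s ≟ deg t) ×-dec (mult t ≤? mult s))

StackPartition : Set
StackPartition = List Stack

PositiveStack : Stack → Set
PositiveStack s = 1 ≤ deg s × 1 ≤ mult s

positiveStack? : (s : Stack) → Dec (PositiveStack s)
positiveStack? s = (1 ≤? deg s) ×-dec (1 ≤? mult s)

IsStackPartition : StackPartition → Set
IsStackPartition τ = All PositiveStack τ × Linked _≥ₛ_ τ

size : StackPartition → ℕ
size τ = sum (map (λ s → deg s * mult s) τ)

_⊩_ : StackPartition → ℕ → Set
τ ⊩ n = IsStackPartition τ × size τ ≡ n

_⊩?_ : (τ : StackPartition) (n : ℕ) → Dec (τ ⊩ n)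
τ ⊩? n = (all? positiveStack? τ ×-dec linked? _≥ₛ?_ τ) ×-dec (size τ ≟ n)

listsUpTo : {A : Set} → ℕ → List A → List (List A)
listsUpTo zero    xs = [ [] ]
listsUpTo (suc k) xs = [] ∷ concatMap (λ x → map (x ∷_) (listsUpTo k xs)) xs

range1 : ℕ → List ℕ
range1 n = applyUpTo suc n

-- the (duplicate-free) list of all stack partitions τ ⊩ n:
-- every such τ has length ≤ n and stacks d^m with 1 ≤ d, m ≤ n.
stackPartitions : ℕ → List StackPartition
stackPartitions n = filter (λ τ → τ ⊩? n) (listsUpTo n (cartesianProduct (range1 n) (range1 n)))

restrict : StackPartition → ℕ → List ℕ
restrict τ u = map mult (filter (λ s → deg s ≟ u) τ)

insertions : {A : Set} → A → List A → List (List A)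
insertions x []       = [ x ∷ [] ]
insertions x (y ∷ ys) = (x ∷ y ∷ ys) ∷ map (y ∷_) (insertions x ys)

perms : {A : Set} → List A → List (List A)
perms []       = [ [] ]
perms (x ∷ xs) = concatMap (insertions x) (perms xs)

rearrangements : List ℕ → List (List ℕ)
rearrangements L = deduplicate (≡-dec _≟_) (perms L)

pad : ℕ → List ℕ → List ℕ
pad ℓ L = L ++ replicate (ℓ ∸ length L) 0

choices : {A : Set} → List (List A) → List (List A)
choices []       = [ [] ]
choices (c ∷ cs) = cartesianProductWith _∷_ c (choices cs)

colSums : ℕ → List (List ℕ) → List ℕ
colSums ℓ rows = foldr (zipWith _+_) (replicate ℓ 0) rows

-- s^τ_α(u): number of r × ℓ(τ|_u) matrices whose i-th row is a rearrangement
-- of α_i|_u padded with zeros and whose column sums are τ|_u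
-- (0 if some ℓ(α_i|_u) > ℓ(τ|_u)).
sCount : StackPartition → List StackPartition → ℕ → ℕ
sCount τ αs u =
  if does (all? (λ a → length (restrict a u) ≤? length (restrict τ u)) αs)
  then length (filter (λ M → ≡-dec _≟_ (colSums (length (restrict τ u)) M) (restrict τ u))
                      (choices (map (λ a → rearrangements (pad (length (restrict τ u)) (restrict a u))) αs)))
  else 0

-- 𝒮^τ_α = ∏_{u ≥ 1} s^τ_α(u).  Only u ≤ |τ| + Σ|α_i| can have a stack of
-- degree u (multiplicities are ≥ 1); for larger u the factor is 1.
calS : StackPartition → List StackPartition → ℕ
calS τ αs = product (applyUpTo (λ i → sCount τ αs (suc i)) (size τ + sum (map size αs)))

-- Monomial polysymmetric functions, evaluated in a commutative semiring
-- with variables x_{d,j} (j = 1..N) given by x d (j-1), and x_{d,j} = 0 for j > N.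

module Eval {c ℓ} (R : CommutativeSemiring c ℓ) where
  open CommutativeSemiring R using (Carrier; 0#; 1#) renaming (_+_ to _⊕_; _*_ to _⊗_)

  sumR : List Carrier → Carrier
  sumR = foldr _⊕_ 0#

  prodR : List Carrier → Carrier
  prodR = foldr _⊗_ 1#

  pow : Carrier → ℕ → Carrier
  pow a zero    = 1#
  pow a (suc k) = a ⊗ pow a k

  natMul : ℕ → Carrier → Carrier
  natMul k a = sumR (replicate k a)

  allVecs : (N s : ℕ) → List (Vec (Fin N) s)
  allVecs N zero    = [ V.[] ]
  allVecs N (suc s) = cartesianProductWith V._∷_ (allFin N) (allVecs N s)

  -- α_i ≠ α_j whenever d_i = d_j, i ≠ j; moreover, to sum over distinct
  -- monomials, α_i < α_j whenever i < j and the stacks i and j are identical.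
  Admissible : {N : ℕ} (τ : StackPartition) → Vec (Fin N) (length τ) → Set
  Admissible τ α = ∀ (k k' : Fin (length τ)) →
    (k ≢ k' → deg (lookup τ k) ≡ deg (lookup τ k') → V.lookup α k ≢ V.lookup α k')
    × (k F.< k' → deg (lookup τ k) ≡ deg (lookup τ k') → mult (lookup τ k) ≡ mult (lookup τ k')
         → V.lookup α k F.< V.lookup α k')

  admissible? : {N : ℕ} (τ : StackPartition) (α : Vec (Fin N) (length τ)) → Dec (Admissible τ α)
  admissible? τ α = FP.all? λ k → FP.all? λ k' →
    (¬? (k FP.≟ k') →-dec ((deg (lookup τ k) ≟ deg (lookup τ k')) →-dec ¬? (V.lookup α k FP.≟ V.lookup α k')))
    ×-dec ((k FP.<? k') →-dec ((deg (lookup τ k) ≟ deg (lookup τ k')) →-dec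
            ((mult (lookup τ k) ≟ mult (lookup τ k')) →-dec (V.lookup α k FP.<? V.lookup α k'))))

  M : (N : ℕ) → (ℕ → Fin N → Carrier) → StackPartition → Carrier
  M N x τ = sumR (map (λ α → prodR (map (λ k → pow (x (deg (lookup τ k)) (V.lookup α k)) (mult (lookup τ k)))
                                       (allFin (length τ))))
                      (filter (admissible? τ) (allVecs N (length τ))))

{-# OPTIONS --safe #-}
-- Expanding the product gives one term for every tuple of monomials, the i-th of shape αᵢ, and that
-- term is the monomial whose exponent of x_{u,i} is the sum of the exponents in the tuple. Sorting
-- its factors x_{u,i}^e by decreasing (u, e) and increasing i shows that every monomial of degree n
-- is the term of exactly one τ ⊩ n with exactly one admissible index vector. Hence the product is
-- the sum over those terms of (number of tuples producing the term) · term, and it remains to count.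
-- Fix the term and, for every degree u, the indices J_u of its degree-u variables. A tuple produces
-- it iff its monomials only use variables indexed by the J_u and, for every u, their degree-u
-- exponents read along J_u (a rearrangement of αᵢ|_u padded with zeros, which determines the
-- monomial) sum to τ|_u. Peeling off the first monomial and inducting on the tuple turns the count
-- into ∏_u s^τ_α(u) = 𝒮^τ_α.
module Submission where

open import Defs
open import Data.Nat using (ℕ)
import Data.Nat as ℕ
open import Data.Fin using (Fin)
open import Data.List using (List; map)
open import Data.Nat.ListAction using (sum)
open import Data.List.Relation.Unary.All using (All)
open import Data.List.Relation.Unary.Unique.Propositional using (Unique)
open import Data.Product using (proj₁)
open import Algebra.Bundles using (CommutativeMonoid; CommutativeSemiring)
open import Level using (Level)

module BigOperators where

  open import Data.Nat using (ℕ; zero; suc) renaming (_+_ to _+ℕ_)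
  open import Data.Nat using (_≤_)
  open import Data.Nat.Properties using (+-*-commutativeSemiring; m≤m+n; m≤n+m; ≤-trans)
  open import Data.Nat.ListAction using (sum; product)
  open import Data.Empty using (⊥-elim)
  open import Data.List.Relation.Unary.All using (all?)
  open import Data.Product using (_×_; _,_; proj₁; proj₂; ∃-syntax)
  open import Data.List using (List; []; _∷_; map; foldr; filter; length; zipWith; _++_; applyUpTo;
    concatMap; cartesianProductWith)
  open import Data.List.Properties using (map-∘; ∷-injective)
  open import Data.List.Relation.Unary.All using (All; []; _∷_)
  open import Data.List.Relation.Unary.Any using (here; there)
  open import Data.List.Relation.Unary.AllPairs using ([]; _∷_)
  open import Data.List.Relation.Unary.Unique.Propositional using (Unique)
  open import Data.List.Relation.Unary.Unique.Propositional.Properties using (Unique[x∷xs]⇒x∉xs)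
  open import Data.List.Membership.Propositional using (_∈_)
  open import Data.List.Membership.Propositional.Properties using (∈-map⁺; ∈-map⁻)
  open import Data.List.Membership.Propositional.Properties.WithK using (unique∧set⇒bag)
  open import Data.List.Relation.Binary.BagAndSetEquality using (∼bag⇒↭)
  open import Data.List.Relation.Binary.Permutation.Propositional as ↭ using (_↭_; ↭-sym)
  open import Data.List.Relation.Binary.Permutation.Propositional.Properties using (∈-resp-↭; drop-∷; ¬x∷xs↭[]; shift)
  open import Data.List.Relation.Unary.Linked as Linked using (Linked)
  open import Data.List.Relation.Unary.Linked.Properties using (Linked⇒AllPairs)
  import Data.List.Relation.Unary.AllPairs as AllPairs
  import Data.List.Relation.Unary.All as All
  import Data.List.Relation.Binary.Permutation.Setoid.Properties as ↭ₛ
  open import Function using (_∘_; mk⇔)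
  open import Relation.Nullary using (Dec; yes; no; ¬_)
  open import Relation.Binary.PropositionalEquality as ≡ using (_≡_; _≢_; refl; cong)

  private
    variable
      a b c : Level
      A B C : Set a

  Unique-map⁺-local : (f : A → B) {xs : List A} → Unique xs →
    (∀ {x y} → x ∈ xs → y ∈ xs → f x ≡ f y → x ≡ y) → Unique (map f xs)
  Unique-map⁺-local f {[]} [] _ = []
  Unique-map⁺-local f {x ∷ xs} (x∉ ∷ u) inj =
    All-≢-map x∉ (inj (here refl) ∘ there) ∷ Unique-map⁺-local f u (λ p q → inj (there p) (there q))
    where
    All-≢-map : ∀ {ys} → All (x ≢_) ys → (∀ {y} → y ∈ ys → f x ≡ f y → x ≡ y) → All (f x ≢_) (map f ys)
    All-≢-map [] _ = []
    All-≢-map (x≢y ∷ ps) i = (x≢y ∘ i (here refl)) ∷ All-≢-map ps (i ∘ there)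

  Unique-resp-↭ : {xs ys : List A} → xs ↭ ys → Unique xs → Unique ys
  Unique-resp-↭ {A = A} = ↭ₛ.Unique-resp-↭ (≡.setoid A) ∘ ↭.↭⇒↭ₛ

  map-≡⇒≡ : {f g : A → B} {xs : List A} → map f xs ≡ map g xs → ∀ {x} → x ∈ xs → f x ≡ g x
  map-≡⇒≡ {xs = _ ∷ _} eq (here refl) = proj₁ (∷-injective eq)
  map-≡⇒≡ {xs = _ ∷ _} eq (there x∈) = map-≡⇒≡ (proj₂ (∷-injective eq)) x∈

  sorted-↭⇒≡ : ∀ {A : Set} {R : A → A → Set} → (∀ {x y z} → R x y → R y z → R x z) →
    (∀ {x y} → R x y → R y x → x ≡ y) → ∀ {xs ys} → Linked R xs → Linked R ys → xs ↭ ys → xs ≡ ys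
  sorted-↭⇒≡ tr anti {[]} {[]} _ _ _ = refl
  sorted-↭⇒≡ tr anti {[]} {y ∷ ys} _ _ p = ⊥-elim (¬x∷xs↭[] (↭-sym p))
  sorted-↭⇒≡ tr anti {x ∷ xs} {[]} _ _ p = ⊥-elim (¬x∷xs↭[] p)
  sorted-↭⇒≡ tr anti {x ∷ xs} {y ∷ ys} lx ly p with heads (∈-resp-↭ p (here refl)) (∈-resp-↭ (↭-sym p) (here refl))
    where
    heads : x ∈ y ∷ ys → y ∈ x ∷ xs → x ≡ y
    heads (here refl) _ = refl
    heads (there _) (here refl) = refl
    heads (there x∈) (there y∈) = anti (All.lookup (AllPairs.head (Linked⇒AllPairs tr lx)) y∈)
                                       (All.lookup (AllPairs.head (Linked⇒AllPairs tr ly)) x∈)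
  ... | refl = cong (x ∷_) (sorted-↭⇒≡ tr anti (Linked.tail lx) (Linked.tail ly) (drop-∷ p))

  ∈-∷-remove : ∀ {A : Set} {z x : A} xs {ys} → z ∈ xs ++ x ∷ ys → z ≢ x → z ∈ xs ++ ys
  ∈-∷-remove xs {ys} z∈ z≢x with ∈-resp-↭ (shift _ xs ys) z∈
  ... | here z≡x = ⊥-elim (z≢x z≡x)
  ... | there z∈′ = z∈′

  applyUpTo-∘ : ∀ {A B : Set} (f : B → A) (g : ℕ → B) k → applyUpTo (f ∘ g) k ≡ map f (applyUpTo g k)
  applyUpTo-∘ f g zero = refl
  applyUpTo-∘ f g (suc k) = cong (f (g 0) ∷_) (applyUpTo-∘ f (g ∘ suc) k)

  module BigOperator {ℓ : Level} (M : CommutativeMonoid c ℓ) where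

    open CommutativeMonoid M renaming (refl to ≈-refl)
    open import Relation.Binary.Reasoning.Setoid setoid
    open import Algebra.Properties.CommutativeSemigroup commutativeSemigroup using (x∙yz≈y∙xz)

    ∑ : (A → Carrier) → List A → Carrier
    ∑ f xs = foldr _∙_ ε (map f xs)

    ∑-cong : ∀ {f g : A → Carrier} (xs : List A) → (∀ {x} → x ∈ xs → f x ≈ g x) → ∑ f xs ≈ ∑ g xs
    ∑-cong [] _ = ≈-refl
    ∑-cong (x ∷ xs) f≈g = ∙-cong (f≈g (here refl)) (∑-cong xs (f≈g ∘ there))

    ∑-ε : ∀ {f : A → Carrier} (xs : List A) → (∀ {x} → x ∈ xs → f x ≈ ε) → ∑ f xs ≈ ε
    ∑-ε [] _ = ≈-refl
    ∑-ε (x ∷ xs) f≈ε = trans (∙-cong (f≈ε (here refl)) (∑-ε xs (f≈ε ∘ there))) (identityˡ ε)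

    ∑-++ : (f : A → Carrier) (xs ys : List A) → ∑ f (xs ++ ys) ≈ ∑ f xs ∙ ∑ f ys
    ∑-++ f [] ys = sym (identityˡ _)
    ∑-++ f (x ∷ xs) ys = trans (∙-congˡ (∑-++ f xs ys)) (sym (assoc _ _ _))

    ∑-∙ : (f g : A → Carrier) (xs : List A) → ∑ (λ x → f x ∙ g x) xs ≈ ∑ f xs ∙ ∑ g xs
    ∑-∙ f g [] = sym (identityˡ ε)
    ∑-∙ f g (x ∷ xs) = begin
      (f x ∙ g x) ∙ ∑ (λ x → f x ∙ g x) xs ≈⟨ ∙-congˡ (∑-∙ f g xs) ⟩
      (f x ∙ g x) ∙ (∑ f xs ∙ ∑ g xs)      ≈⟨ assoc _ _ _ ⟩
      f x ∙ (g x ∙ (∑ f xs ∙ ∑ g xs))      ≈⟨ ∙-congˡ (x∙yz≈y∙xz _ _ _) ⟩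
      f x ∙ (∑ f xs ∙ (g x ∙ ∑ g xs))      ≈⟨ assoc _ _ _ ⟨
      (f x ∙ ∑ f xs) ∙ (g x ∙ ∑ g xs)      ∎

    ∑-swap : (F : A → B → Carrier) (xs : List A) (ys : List B) →
      ∑ (λ x → ∑ (F x) ys) xs ≈ ∑ (λ y → ∑ (λ x → F x y) xs) ys
    ∑-swap F [] ys = sym (∑-ε ys (λ _ → ≈-refl))
    ∑-swap F (x ∷ xs) ys = trans (∙-congˡ (∑-swap F xs ys)) (sym (∑-∙ (F x) _ ys))

    ∑-concatMap : (f : B → Carrier) (g : A → List B) (xs : List A) → ∑ f (concatMap g xs) ≈ ∑ (∑ f ∘ g) xs
    ∑-concatMap f g [] = ≈-refl
    ∑-concatMap f g (x ∷ xs) = trans (∑-++ f (g x) (concatMap g xs)) (∙-congˡ (∑-concatMap f g xs))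

    ∑-cartesianProductWith : (g : A → B → C) (f : C → Carrier) (xs : List A) (ys : List B) →
      ∑ f (cartesianProductWith g xs ys) ≈ ∑ (λ x → ∑ (f ∘ g x) ys) xs
    ∑-cartesianProductWith g f [] ys = ≈-refl
    ∑-cartesianProductWith g f (x ∷ xs) ys = begin
      ∑ f (map (g x) ys ++ cartesianProductWith g xs ys)      ≈⟨ ∑-++ f (map (g x) ys) _ ⟩
      ∑ f (map (g x) ys) ∙ ∑ f (cartesianProductWith g xs ys)
        ≈⟨ ∙-cong (reflexive (≡.cong (foldr _∙_ ε) (≡.sym (map-∘ ys)))) (∑-cartesianProductWith g f xs ys) ⟩
      ∑ (f ∘ g x) ys ∙ ∑ (λ x → ∑ (f ∘ g x) ys) xs            ∎

    ∑-single : (f : A → Carrier) {xs : List A} → Unique xs → ∀ {y} → y ∈ xs →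
      (∀ {x} → x ∈ xs → x ≢ y → f x ≈ ε) → ∑ f xs ≈ f y
    ∑-single f {x ∷ xs} u (here refl) others =
      trans (∙-congˡ (∑-ε xs (λ p → others (there p) (λ { refl → Unique[x∷xs]⇒x∉xs u p })))) (identityʳ _)
    ∑-single f {x ∷ xs} u@(_ ∷ u′) (there p) others =
      trans (∙-congʳ (others (here refl) (λ { refl → Unique[x∷xs]⇒x∉xs u p }))) (trans (identityˡ _)
        (∑-single f u′ p (others ∘ there)))

    ∑-filter : ∀ {p} {P : A → Set p} (P? : ∀ x → Dec (P x)) (f : A → Carrier) (xs : List A) →
      (∀ {x} → x ∈ xs → ¬ P x → f x ≈ ε) → ∑ f xs ≈ ∑ f (filter P? xs)
    ∑-filter P? f [] _ = ≈-refl
    ∑-filter P? f (x ∷ xs) off with P? x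
    ... | yes _ = ∙-congˡ (∑-filter P? f xs (off ∘ there))
    ... | no ¬px = trans (∙-congʳ (off (here refl) ¬px)) (trans (identityˡ _) (∑-filter P? f xs (off ∘ there)))

    ∑-↭ : (f : A → Carrier) {xs ys : List A} → xs ↭ ys → ∑ f xs ≈ ∑ f ys
    ∑-↭ f ↭.refl = ≈-refl
    ∑-↭ f (↭.prep x p) = ∙-congˡ (∑-↭ f p)
    ∑-↭ f (↭.swap x y p) = trans (∙-congˡ (∙-congˡ (∑-↭ f p))) (x∙yz≈y∙xz _ _ _)
    ∑-↭ f (↭.trans p q) = trans (∑-↭ f p) (∑-↭ f q)

    ∑-bijection : (φ : A → B) (g : B → Carrier) {xs : List A} {ys : List B} → Unique xs → Unique ys →
      (∀ {x} → x ∈ xs → φ x ∈ ys) →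
      (∀ {x x′} → x ∈ xs → x′ ∈ xs → φ x ≡ φ x′ → x ≡ x′) →
      (∀ {y} → y ∈ ys → ∃[ x ] (x ∈ xs × φ x ≡ y)) →
      ∑ (g ∘ φ) xs ≈ ∑ g ys
    ∑-bijection φ g {xs} {ys} uxs uys into inj onto =
      trans (reflexive (≡.cong (foldr _∙_ ε) (map-∘ xs)))
        (∑-↭ g (∼bag⇒↭ (unique∧set⇒bag (Unique-map⁺-local φ uxs inj) uys (mk⇔ to from))))
      where
      to : ∀ {y} → y ∈ map φ xs → y ∈ ys
      to p with ∈-map⁻ φ p
      ... | x , x∈ , refl = into x∈
      from : ∀ {y} → y ∈ ys → y ∈ map φ xs
      from p with onto p
      ... | x , x∈ , refl = ∈-map⁺ φ x∈

  indicator : ∀ {p} {P : Set p} → Dec P → ℕ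
  indicator (yes _) = 1
  indicator (no _) = 0

  module SemiringSums {ℓ : Level} (R : CommutativeSemiring c ℓ) where

    open CommutativeSemiring R renaming (refl to ≈-refl)
    open Eval R using (prodR; natMul; pow)
    open import Relation.Binary.Reasoning.Setoid setoid

    open BigOperator +-commutativeMonoid public
    open BigOperator *-commutativeMonoid public using () renaming
      (∑ to ∏; ∑-cong to ∏-cong)

    *-∑ˡ : ∀ a (f : A → Carrier) (xs : List A) → a * ∑ f xs ≈ ∑ (λ x → a * f x) xs
    *-∑ˡ a f [] = zeroʳ a
    *-∑ˡ a f (x ∷ xs) = trans (distribˡ a (f x) _) (+-congˡ (*-∑ˡ a f xs))

    ∑-*ʳ : ∀ a (f : A → Carrier) (xs : List A) → ∑ f xs * a ≈ ∑ (λ x → f x * a) xs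
    ∑-*ʳ a f [] = zeroˡ a
    ∑-*ʳ a f (x ∷ xs) = trans (distribʳ a (f x) _) (+-congˡ (∑-*ʳ a f xs))

    ∑-*-∑ : (g : A → B → C) (f : A → Carrier) (h : B → Carrier) (F : C → Carrier) (xs : List A) (ys : List B) →
      (∀ x y → F (g x y) ≈ f x * h y) → ∑ f xs * ∑ h ys ≈ ∑ F (cartesianProductWith g xs ys)
    ∑-*-∑ g f h F xs ys F∘g≈f*h = begin
      ∑ f xs * ∑ h ys                      ≈⟨ ∑-*ʳ _ f xs ⟩
      ∑ (λ x → f x * ∑ h ys) xs            ≈⟨ ∑-cong xs (λ {x} _ → *-∑ˡ (f x) h ys) ⟩
      ∑ (λ x → ∑ (λ y → f x * h y) ys) xs  ≈⟨ ∑-cong xs (λ {x} _ → ∑-cong ys (λ {y} _ → sym (F∘g≈f*h x y))) ⟩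
      ∑ (λ x → ∑ (F ∘ g x) ys) xs          ≈⟨ ∑-cartesianProductWith g F xs ys ⟨
      ∑ F (cartesianProductWith g xs ys)   ∎

    ∏-∑-choices : (us : List A) (S : A → List B) (g : A → B → Carrier) →
      ∏ (λ u → ∑ (g u) (S u)) us ≈ ∑ (λ rs → prodR (zipWith g us rs)) (choices (map S us))
    ∏-∑-choices [] S g = sym (+-identityʳ 1#)
    ∏-∑-choices (u ∷ us) S g = trans (*-congˡ (∏-∑-choices us S g))
      (∑-*-∑ _∷_ (g u) (λ rs → prodR (zipWith g us rs)) (λ rs → prodR (zipWith g (u ∷ us) rs)) (S u) _ (λ _ _ → ≈-refl))

    ∏-0 : (f : A → Carrier) (xs : List A) {x : A} → x ∈ xs → f x ≈ 0# → ∏ f xs ≈ 0#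
    ∏-0 f (y ∷ xs) (here refl) fx≈0 = trans (*-congʳ fx≈0) (zeroˡ _)
    ∏-0 f (y ∷ xs) (there p) fx≈0 = trans (*-congˡ (∏-0 f xs p fx≈0)) (zeroʳ _)

    natMul-+ : ∀ m n a → natMul (m +ℕ n) a ≈ natMul m a + natMul n a
    natMul-+ zero n a = sym (+-identityˡ _)
    natMul-+ (suc m) n a = trans (+-congˡ (natMul-+ m n a)) (sym (+-assoc _ _ _))

    natMul-∑ˡ : (f : A → ℕ) (xs : List A) (a : Carrier) →
      natMul (sum (map f xs)) a ≈ ∑ (λ x → natMul (f x) a) xs
    natMul-∑ˡ f [] a = ≈-refl
    natMul-∑ˡ f (x ∷ xs) a = trans (natMul-+ (f x) _ a) (+-congˡ (natMul-∑ˡ f xs a))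

    natMul-∑ʳ : ∀ m (f : A → Carrier) (xs : List A) → natMul m (∑ f xs) ≈ ∑ (λ x → natMul m (f x)) xs
    natMul-∑ʳ zero f xs = sym (∑-ε xs (λ _ → ≈-refl))
    natMul-∑ʳ (suc m) f xs = trans (+-congˡ (natMul-∑ʳ m f xs)) (sym (∑-∙ f _ xs))

    pow-+ : ∀ a m n → pow a (m +ℕ n) ≈ pow a m * pow a n
    pow-+ a zero n = sym (*-identityˡ _)
    pow-+ a (suc m) n = trans (*-congˡ (pow-+ a m n)) (sym (*-assoc _ _ _))

    ∑-fibres : ∀ {p} (Pr : A → B → Set p) (Pr? : ∀ t u → Dec (Pr t u)) (f : A → Carrier) (h : B → Carrier)
      (ts : List A) (us : List B) →
      (∀ {t} → t ∈ ts → sum (map (λ u → indicator (Pr? t u)) us) ≡ 1) →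
      (∀ {t u} → t ∈ ts → u ∈ us → Pr t u → f t ≈ h u) →
      ∑ f ts ≈ ∑ (λ u → natMul (sum (map (λ t → indicator (Pr? t u)) ts)) (h u)) us
    ∑-fibres Pr Pr? f h ts us unique-fibre f≈h = sym (begin
      ∑ (λ u → natMul (sum (map (λ t → indicator (Pr? t u)) ts)) (h u)) us
        ≈⟨ ∑-cong us (λ {u} _ → natMul-∑ˡ (λ t → indicator (Pr? t u)) ts (h u)) ⟩
      ∑ (λ u → ∑ (λ t → natMul (indicator (Pr? t u)) (h u)) ts) us
        ≈⟨ ∑-swap (λ u t → natMul (indicator (Pr? t u)) (h u)) us ts ⟩
      ∑ (λ t → ∑ (λ u → natMul (indicator (Pr? t u)) (h u)) us) ts
        ≈⟨ ∑-cong ts (λ {t} t∈ → ∑-cong us (λ {u} u∈ → on-fibre t u t∈ u∈ (Pr? t u))) ⟩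
      ∑ (λ t → ∑ (λ u → natMul (indicator (Pr? t u)) (f t)) us) ts
        ≈⟨ ∑-cong ts (λ {t} _ → natMul-∑ˡ (λ u → indicator (Pr? t u)) us (f t)) ⟨
      ∑ (λ t → natMul (sum (map (λ u → indicator (Pr? t u)) us)) (f t)) ts
        ≈⟨ ∑-cong ts (λ {t} t∈ → trans (reflexive (≡.cong (λ k → natMul k (f t)) (unique-fibre t∈))) (+-identityʳ (f t))) ⟩
      ∑ f ts ∎)
      where
      on-fibre : ∀ t u → t ∈ ts → u ∈ us → (d : Dec (Pr t u)) → natMul (indicator d) (h u) ≈ natMul (indicator d) (f t)
      on-fibre t u t∈ u∈ (yes p) = +-congʳ (sym (f≈h t∈ u∈ p))
      on-fibre t u t∈ u∈ (no _) = ≈-refl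

  module Nat = SemiringSums +-*-commutativeSemiring

  length-filter≡∑indicator : ∀ {p} {P : A → Set p} (P? : ∀ x → Dec (P x)) (xs : List A) →
    length (filter P? xs) ≡ sum (map (indicator ∘ P?) xs)
  length-filter≡∑indicator P? [] = refl
  length-filter≡∑indicator P? (x ∷ xs) with P? x
  ... | yes _ = ≡.cong suc (length-filter≡∑indicator P? xs)
  ... | no _ = length-filter≡∑indicator P? xs

  indicator-cong : ∀ {p q} {P : Set p} {Q : Set q} (p? : Dec P) (q? : Dec Q) → (P → Q) → (Q → P) → indicator p? ≡ indicator q?
  indicator-cong (yes _) (yes _) _ _ = refl
  indicator-cong (no _) (no _) _ _ = refl
  indicator-cong (yes p) (no ¬q) P→Q _ = ⊥-elim (¬q (P→Q p))
  indicator-cong (no ¬p) (yes q) _ Q→P = ⊥-elim (¬p (Q→P q))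

  indicator-no : ∀ {p} {P : Set p} (p? : Dec P) → ¬ P → indicator p? ≡ 0
  indicator-no (yes p) ¬p = ⊥-elim (¬p p)
  indicator-no (no _) _ = refl

  ∑indicator≡1 : ∀ {p} {P : A → Set p} (P? : ∀ x → Dec (P x)) {xs : List A} → Unique xs →
    ∀ {x} → x ∈ xs → P x → (∀ {y} → y ∈ xs → P y → y ≡ x) → sum (map (indicator ∘ P?) xs) ≡ 1
  ∑indicator≡1 P? u {x} x∈ px only =
    ≡.trans (Nat.∑-single (indicator ∘ P?) u x∈ (λ y∈ y≢x → indicator-no (P? _) (y≢x ∘ only y∈)))
    (indicator-cong (P? x) (yes px) (λ _ → px) (λ _ → px))

  ∏indicator≡indicator-all : ∀ {p} {P : A → Set p} (P? : ∀ x → Dec (P x)) (xs : List A) →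
    product (map (indicator ∘ P?) xs) ≡ indicator (all? P? xs)
  ∏indicator≡indicator-all P? [] = refl
  ∏indicator≡indicator-all P? (x ∷ xs) with P? x | all? P? xs | ∏indicator≡indicator-all P? xs
  ... | yes _ | yes _ | eq = ≡.cong (_+ℕ 0) eq
  ... | yes _ | no _ | eq = ≡.cong (_+ℕ 0) eq
  ... | no _ | yes _ | _ = refl
  ... | no _ | no _ | _ = refl

  ≤-∑ : (f : A → ℕ) {xs : List A} {x : A} → x ∈ xs → f x ≤ sum (map f xs)
  ≤-∑ f (here refl) = m≤m+n _ _
  ≤-∑ f {y ∷ _} (there p) = ≤-trans (≤-∑ f p) (m≤n+m _ (f y))

module Stacks where

  open import Data.Nat using (ℕ; zero; suc; _*_; _∸_; _≤_; _<_; z≤n; _≟_; >-nonZero)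
  open import Data.Nat.Properties using (≤-trans; <-trans; +-mono-≤; m≤m*n; m≤n*m; <⇒≢; <-asym; ≤-antisym)
  open import Data.Product using (_,_)
  open import Data.Sum using (inj₁; inj₂)
  open import Data.Empty using (⊥-elim)
  open import Data.List using (List; []; _∷_; map; filter; length; replicate; concatMap; _++_)
  open import Data.List.Properties using (filter-++; filter-all; filter-none; filter-accept; filter-reject; ++-identityʳ)
  open import Data.List.Relation.Unary.All as All using (All; []; _∷_)
  open import Data.List.Relation.Unary.Any using (here; there)
  open import Data.List.Relation.Unary.AllPairs using (_∷_)
  open import Data.List.Relation.Unary.Unique.Propositional using (Unique)
  open import Data.List.Membership.Propositional using (_∈_; _∉_)
  open import Data.List.Relation.Binary.Permutation.Propositional using (_↭_; ↭-trans; ↭-reflexive; prep)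
  import Data.List.Relation.Binary.Permutation.Propositional.Properties as ↭
  open import Function using (_∘_)
  open import Relation.Nullary using (Dec; yes; no; ¬_; ¬?)
  open import Relation.Binary.PropositionalEquality using (_≡_; _≢_; refl; sym; trans; cong; cong₂; subst)
  open BigOperators using (≤-∑)

  stackSize : Stack → ℕ
  stackSize s = deg s * mult s

  length≤size : ∀ {τ} → All PositiveStack τ → length τ ≤ size τ
  length≤size [] = z≤n
  length≤size {(d , m) ∷ τ} ((1≤d , 1≤m) ∷ ps) =
    +-mono-≤ (≤-trans 1≤m (m≤n*m m d {{>-nonZero 1≤d}})) (length≤size ps)

  deg≤size : ∀ {τ s} → PositiveStack s → s ∈ τ → deg s ≤ size τ
  deg≤size {τ} {d , m} (_ , 1≤m) s∈ = ≤-trans (m≤m*n d m {{>-nonZero 1≤m}}) (≤-∑ stackSize s∈)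

  mult≤size : ∀ {τ s} → PositiveStack s → s ∈ τ → mult s ≤ size τ
  mult≤size {τ} {d , m} (1≤d , _) s∈ = ≤-trans (m≤n*m m d {{>-nonZero 1≤d}}) (≤-∑ stackSize s∈)

  nonzero? : (μ : ℕ) → Dec (μ ≢ 0)
  nonzero? μ = ¬? (μ ≟ 0)

  ≥ₛ-trans : ∀ {s t r} → s ≥ₛ t → t ≥ₛ r → s ≥ₛ r
  ≥ₛ-trans (inj₁ x) (inj₁ y) = inj₁ (<-trans y x)
  ≥ₛ-trans (inj₁ x) (inj₂ (e , _)) = inj₁ (subst (_< _) e x)
  ≥ₛ-trans (inj₂ (e , _)) (inj₁ y) = inj₁ (subst (_ <_) (sym e) y)
  ≥ₛ-trans (inj₂ (e , x)) (inj₂ (e′ , y)) = inj₂ (trans e e′ , ≤-trans y x)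

  ≥ₛ-antisym : ∀ {s t} → s ≥ₛ t → t ≥ₛ s → s ≡ t
  ≥ₛ-antisym (inj₁ x) (inj₁ y) = ⊥-elim (<-asym x y)
  ≥ₛ-antisym (inj₁ x) (inj₂ (e , _)) = ⊥-elim (<⇒≢ x e)
  ≥ₛ-antisym (inj₂ (e , _)) (inj₁ y) = ⊥-elim (<⇒≢ y e)
  ≥ₛ-antisym {d , _} (inj₂ (refl , x)) (inj₂ (_ , y)) = cong (d ,_) (≤-antisym y x)

  restrict-pairs : ∀ u (α : StackPartition) → map (u ,_) (restrict α u) ≡ filter (λ s → deg s ≟ u) α
  restrict-pairs u [] = refl
  restrict-pairs u (s ∷ α) with deg s ≟ u
  ... | yes refl rewrite filter-accept (λ t → deg t ≟ u) {x = s} {xs = α} refl = cong (s ∷_) (restrict-pairs u α)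
  ... | no ≢u rewrite filter-reject (λ t → deg t ≟ u) {x = s} {xs = α} ≢u = restrict-pairs u α

  restrict-nonzero : ∀ u {α} → All PositiveStack α → All (_≢ 0) (restrict α u)
  restrict-nonzero u {[]} [] = []
  restrict-nonzero u {s ∷ α} ((_ , 1≤m) ∷ ps) with deg s ≟ u
  ... | yes ≡u rewrite filter-accept (λ t → deg t ≟ u) {x = s} {xs = α} ≡u =
    (λ m≡0 → <⇒≢ 1≤m (sym m≡0)) ∷ restrict-nonzero u ps
  ... | no ≢u rewrite filter-reject (λ t → deg t ≟ u) {x = s} {xs = α} ≢u = restrict-nonzero u ps

  filter-nonzero-pad : ∀ ℓ {L} → All (_≢ 0) L → filter nonzero? (pad ℓ L) ≡ L
  filter-nonzero-pad ℓ {L} L≢0 = trans (filter-++ nonzero? L _)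
    (trans (cong₂ _++_ (filter-all nonzero? L≢0) (filter-none nonzero? (zeros (ℓ ∸ length L)))) (++-identityʳ L))
    where
    zeros : ∀ k → All (λ μ → ¬ (μ ≢ 0)) (replicate k 0)
    zeros zero = []
    zeros (suc k) = (λ ≢0 → ≢0 refl) ∷ zeros k

  byDegree : List ℕ → StackPartition → StackPartition
  byDegree us α = concatMap (λ u → filter (λ s → deg s ≟ u) α) us

  byDegree-∉ : ∀ us {s} α → deg s ∉ us → byDegree us (s ∷ α) ≡ byDegree us α
  byDegree-∉ [] α _ = refl
  byDegree-∉ (u ∷ us) {s} α s∉ = cong₂ _++_ (filter-reject (λ t → deg t ≟ u) (s∉ ∘ here)) (byDegree-∉ us α (s∉ ∘ there))

  byDegree-∈ : ∀ {us} {s} α → Unique us → deg s ∈ us → byDegree us (s ∷ α) ↭ s ∷ byDegree us α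
  byDegree-∈ {u ∷ us} {s} α (u∉ ∷ _) (here refl) = ↭-reflexive
    (cong₂ _++_ (filter-accept (λ t → deg t ≟ u) refl) (byDegree-∉ us α (λ s∈ → All.lookup u∉ s∈ refl)))
  byDegree-∈ {u ∷ us} {s} α (u∉ ∷ uus) (there s∈) rewrite filter-reject (λ t → deg t ≟ u) {x = s} {xs = α}
    (λ { refl → All.lookup u∉ s∈ refl }) =
    ↭-trans (↭.++⁺ˡ (filter (λ t → deg t ≟ u) α) (byDegree-∈ α uus s∈)) (↭.shift s _ _)

  byDegree-↭ : ∀ {us} α → Unique us → All (λ s → deg s ∈ us) α → byDegree us α ↭ α
  byDegree-↭ {us} [] _ _ = ↭-reflexive (concatMap-[] us)
    where
    concatMap-[] : ∀ us → byDegree us [] ≡ []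
    concatMap-[] [] = refl
    concatMap-[] (_ ∷ us) = concatMap-[] us
  byDegree-↭ (s ∷ α) uus (s∈ ∷ α∈) = ↭-trans (byDegree-∈ α uus s∈) (prep s (byDegree-↭ α uus α∈))

module Enumerations where

  open import Data.Nat using (ℕ; zero; suc; _≤_; z≤n; s≤s; _≟_)
  open import Data.Nat.Properties using (suc-injective; <-irrefl)
  open import Data.Fin using (Fin)
  open import Data.Product using (_,_; proj₁; proj₂)
  open import Data.List using (List; []; _∷_; map; length; concatMap; _++_;
    cartesianProductWith; cartesianProduct)
  open import Data.List.Properties using (∷-injective; ≡-dec)
  open import Data.List.Relation.Unary.All as All using (All; []; _∷_)
  open import Data.List.Relation.Unary.Any using (here; there)
  open import Data.List.Relation.Unary.AllPairs using ([]; _∷_)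
  open import Data.List.Relation.Unary.Unique.Propositional using (Unique)
  import Data.List.Relation.Unary.Unique.Propositional.Properties as Unique
  import Data.List.Relation.Unary.Unique.DecPropositional.Properties as DecUnique
  open import Data.List.Relation.Binary.Pointwise using (Pointwise; []; _∷_)
  open import Data.List.Membership.Propositional using (_∈_; find; lose)
  open import Data.List.Membership.Propositional.Properties using (∈-map⁺; ∈-map⁻; ∈-∃++; ∈-concatMap⁺; ∈-concatMap⁻;
    ∈-cartesianProductWith⁺; ∈-cartesianProductWith⁻; ∈-deduplicate⁺; ∈-deduplicate⁻; ∈-applyUpTo⁺; ∈-applyUpTo⁻;
    ∈-filter⁺; ∈-filter⁻; ∈-allFin)
  open import Data.List.Relation.Binary.Permutation.Propositional using (_↭_; ↭-refl; ↭-sym; ↭-trans; prep; swap)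
  open import Data.List.Relation.Binary.Permutation.Propositional.Properties using (shift; drop-∷; ↭-empty-inv; ∈-resp-↭)
  open import Data.Vec as Vec using (Vec)
  import Data.Vec.Properties as Vec
  open import Function using (_∘_)
  open import Relation.Binary.PropositionalEquality using (_≡_; _≢_; refl; sym; cong; subst)
  open Stacks using (length≤size; deg≤size; mult≤size)

  ∈-insertions⁻ : ∀ {A : Set} (x : A) ys {zs} → zs ∈ insertions x ys → zs ↭ x ∷ ys
  ∈-insertions⁻ x [] (here refl) = ↭-refl
  ∈-insertions⁻ x (y ∷ ys) (here refl) = ↭-refl
  ∈-insertions⁻ x (y ∷ ys) (there p) with ∈-map⁻ (y ∷_) p
  ... | zs , zs∈ , refl = ↭-trans (prep y (∈-insertions⁻ x ys zs∈)) (swap y x ↭-refl)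

  ∈-insertions⁺ : ∀ {A : Set} (x : A) as bs → as ++ x ∷ bs ∈ insertions x (as ++ bs)
  ∈-insertions⁺ x [] [] = here refl
  ∈-insertions⁺ x [] (b ∷ bs) = here refl
  ∈-insertions⁺ x (a ∷ as) bs = there (∈-map⁺ (a ∷_) (∈-insertions⁺ x as bs))

  ∈-perms⁻ : ∀ {A : Set} (xs : List A) {zs} → zs ∈ perms xs → zs ↭ xs
  ∈-perms⁻ [] (here refl) = ↭-refl
  ∈-perms⁻ (x ∷ xs) p with find (∈-concatMap⁻ (insertions x) {xs = perms xs} p)
  ... | ys , ys∈ , zs∈ = ↭-trans (∈-insertions⁻ x ys zs∈) (prep x (∈-perms⁻ xs ys∈))

  ∈-perms⁺ : ∀ {A : Set} (xs : List A) {zs} → zs ↭ xs → zs ∈ perms xs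
  ∈-perms⁺ [] p with ↭-empty-inv p
  ... | refl = here refl
  ∈-perms⁺ (x ∷ xs) p with ∈-∃++ (∈-resp-↭ (↭-sym p) (here refl))
  ... | as , bs , refl = ∈-concatMap⁺ (insertions x) (lose
    (∈-perms⁺ xs (drop-∷ (↭-trans (↭-sym (shift x as bs)) p))) (∈-insertions⁺ x as bs))

  ∈-rearrangements⁻ : ∀ xs {zs} → zs ∈ rearrangements xs → zs ↭ xs
  ∈-rearrangements⁻ xs = ∈-perms⁻ xs ∘ ∈-deduplicate⁻ (≡-dec _≟_) (perms xs)

  ∈-rearrangements⁺ : ∀ xs {zs} → zs ↭ xs → zs ∈ rearrangements xs
  ∈-rearrangements⁺ xs = ∈-deduplicate⁺ (≡-dec _≟_) ∘ ∈-perms⁺ xs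

  rearrangements-unique : ∀ xs → Unique (rearrangements xs)
  rearrangements-unique xs = DecUnique.deduplicate-! (≡-dec _≟_) (perms xs)

  ∈-choices⁻ : ∀ {A : Set} (Ss : List (List A)) {rs} → rs ∈ choices Ss → Pointwise _∈_ rs Ss
  ∈-choices⁻ [] (here refl) = []
  ∈-choices⁻ (S ∷ Ss) p with ∈-cartesianProductWith⁻ _∷_ S (choices Ss) p
  ... | r , rs , r∈ , rs∈ , refl = r∈ ∷ ∈-choices⁻ Ss rs∈

  ∈-choices⁺ : ∀ {A : Set} {Ss : List (List A)} {rs} → Pointwise _∈_ rs Ss → rs ∈ choices Ss
  ∈-choices⁺ [] = here refl
  ∈-choices⁺ (r∈ ∷ rs∈) = ∈-cartesianProductWith⁺ _∷_ r∈ (∈-choices⁺ rs∈)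

  choices-unique : ∀ {A : Set} {Ss : List (List A)} → All Unique Ss → Unique (choices Ss)
  choices-unique [] = [] ∷ []
  choices-unique (u ∷ us) = Unique.cartesianProductWith⁺ _∷_ ∷-injective u (choices-unique us)

  ∈-range1⁺ : ∀ {u K} → 1 ≤ u → u ≤ K → u ∈ range1 K
  ∈-range1⁺ {suc u} (s≤s _) u≤K = ∈-applyUpTo⁺ suc u≤K

  ∈-range1⁻ : ∀ {u K} → u ∈ range1 K → 1 ≤ u
  ∈-range1⁻ p with ∈-applyUpTo⁻ suc p
  ... | _ , _ , refl = s≤s z≤n

  range1-unique : ∀ K → Unique (range1 K)
  range1-unique K = Unique.applyUpTo⁺₁ suc K (λ i<j _ eq → <-irrefl (suc-injective eq) i<j)

  concatMap-prepend : ∀ {A : Set} (xs : List A) (Ls : List (List A)) →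
    concatMap (λ x → map (x ∷_) Ls) xs ≡ cartesianProductWith _∷_ xs Ls
  concatMap-prepend [] Ls = refl
  concatMap-prepend (x ∷ xs) Ls = cong (map (x ∷_) Ls ++_) (concatMap-prepend xs Ls)

  ∈-listsUpTo⁺ : ∀ {A : Set} k (xs : List A) {ys} → length ys ≤ k → All (_∈ xs) ys → ys ∈ listsUpTo k xs
  ∈-listsUpTo⁺ zero xs {[]} _ _ = here refl
  ∈-listsUpTo⁺ (suc k) xs {[]} _ _ = here refl
  ∈-listsUpTo⁺ (suc k) xs {y ∷ ys} (s≤s ys≤k) (y∈ ∷ ys∈) = there (subst ((y ∷ ys) ∈_)
    (sym (concatMap-prepend xs (listsUpTo k xs))) (∈-cartesianProductWith⁺ _∷_ y∈ (∈-listsUpTo⁺ k xs ys≤k ys∈)))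

  listsUpTo-unique : ∀ {A : Set} k {xs : List A} → Unique xs → Unique (listsUpTo k xs)
  listsUpTo-unique zero u = [] ∷ []
  listsUpTo-unique (suc k) {xs} u rewrite concatMap-prepend xs (listsUpTo k xs) =
    All.tabulate []∉ ∷ Unique.cartesianProductWith⁺ _∷_ ∷-injective u (listsUpTo-unique k u)
    where
    []∉ : ∀ {ys} → ys ∈ cartesianProductWith _∷_ xs (listsUpTo k xs) → [] ≢ ys
    []∉ p refl with ∈-cartesianProductWith⁻ _∷_ xs (listsUpTo k xs) p
    ... | _ , _ , _ , _ , ()

  stackPartitions-unique : ∀ n → Unique (stackPartitions n)
  stackPartitions-unique n = Unique.filter⁺ (_⊩? n) (listsUpTo-unique n (Unique.cartesianProduct⁺ (range1-unique n) (range1-unique n)))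

  ∈-stackPartitions⁻ : ∀ {n τ} → τ ∈ stackPartitions n → τ ⊩ n
  ∈-stackPartitions⁻ {n} = proj₂ ∘ ∈-filter⁻ (_⊩? n) {xs = listsUpTo n (cartesianProduct (range1 n) (range1 n))}

  ∈-stackPartitions⁺ : ∀ {n τ} → τ ⊩ n → τ ∈ stackPartitions n
  ∈-stackPartitions⁺ {n} {τ} τ⊩n@((ps , _) , refl) = ∈-filter⁺ (_⊩? n)
    (∈-listsUpTo⁺ n _ (length≤size ps) (All.tabulate stack∈)) τ⊩n
    where
    stack∈ : ∀ {s} → s ∈ τ → s ∈ cartesianProduct (range1 n) (range1 n)
    stack∈ s∈ = let ps = All.lookup ps s∈ in
      ∈-cartesianProductWith⁺ _,_ (∈-range1⁺ (proj₁ ps) (deg≤size ps s∈)) (∈-range1⁺ (proj₂ ps) (mult≤size ps s∈))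

  -- allVecs lives in Eval, although it does not depend on the semiring
  module _ {c ℓ} (R : CommutativeSemiring c ℓ) (N : ℕ) where

    open Eval R using (allVecs)

    ∈-allVecs : ∀ {s} (v : Vec (Fin N) s) → v ∈ allVecs N s
    ∈-allVecs Vec.[] = here refl
    ∈-allVecs (j Vec.∷ v) = ∈-cartesianProductWith⁺ Vec._∷_ (∈-allFin j) (∈-allVecs v)

    allVecs-unique : ∀ s → Unique (allVecs N s)
    allVecs-unique zero = [] ∷ []
    allVecs-unique (suc s) = Unique.cartesianProductWith⁺ Vec._∷_ Vec.∷-injective (Unique.allFin⁺ N) (allVecs-unique s)

module Matrices where

  open import Data.Nat using (ℕ; _+_; _∸_; _⊓_; _≤_; _≟_; _≤?_)
  open import Data.Nat.Properties using (+-identityʳ; m+n∸m≡n; m+[n∸m]≡n; m≤m+n; suc-injective; ⊓-idem)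
  open import Data.Product using (_×_; _,_; proj₁; proj₂)
  open import Data.Bool using (if_then_else_)
  open import Data.List using (List; []; _∷_; [_]; map; filter; length; replicate; zipWith; cartesianProductWith)
  open import Data.List.Properties using (≡-dec; ∷-injective; length-replicate; length-++; length-zipWith)
  open import Data.Nat.ListAction using (sum)
  open import Data.List.Relation.Unary.All as All using (All; []; _∷_; all?)
  open import Data.List.Relation.Binary.Pointwise as Pointwise using (Pointwise; []; _∷_)
  open import Data.List.Membership.Propositional using (_∈_)
  open import Data.List.Relation.Binary.Permutation.Propositional.Properties using (↭-length)
  open import Data.Empty using (⊥-elim)
  open import Relation.Nullary using (Dec; yes; no; ¬_; does)
  open import Relation.Binary.PropositionalEquality using (_≡_; refl; sym; trans; cong; cong₂)
  open Relation.Binary.PropositionalEquality.≡-Reasoning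
  open BigOperators using (module Nat; indicator; length-filter≡∑indicator; indicator-cong; indicator-no)
  open Enumerations using (∈-rearrangements⁻; ∈-choices⁻)

  Fits : ℕ → ℕ → StackPartition → Set
  Fits ℓ u α = length (restrict α u) ≤ ℓ

  rowsOf : ℕ → ℕ → StackPartition → List (List ℕ)
  rowsOf ℓ u α = rearrangements (pad ℓ (restrict α u))

  matrixCount : ℕ → List ℕ → List StackPartition → ℕ → ℕ
  matrixCount ℓ c αs u =
    if does (all? (λ a → length (restrict a u) ≤? ℓ) αs)
    then length (filter (λ M → ≡-dec _≟_ (colSums ℓ M) c) (choices (map (rowsOf ℓ u) αs)))
    else 0

  sCount≡matrixCount : ∀ τ αs u → sCount τ αs u ≡ matrixCount (length (restrict τ u)) (restrict τ u) αs u
  sCount≡matrixCount τ αs u = refl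

  matrixCount-fits : ∀ {ℓ c αs u} → All (Fits ℓ u) αs →
    matrixCount ℓ c αs u ≡ sum (map (λ M → indicator (≡-dec _≟_ (colSums ℓ M) c)) (choices (map (rowsOf ℓ u) αs)))
  matrixCount-fits {ℓ} {c} {αs} {u} fits with all? (λ a → length (restrict a u) ≤? ℓ) αs
  ... | yes _ = length-filter≡∑indicator (λ M → ≡-dec _≟_ (colSums ℓ M) c) (choices (map (rowsOf ℓ u) αs))
  ... | no ¬fits = ⊥-elim (¬fits fits)

  matrixCount-¬fits : ∀ {ℓ c αs u} → ¬ All (Fits ℓ u) αs → matrixCount ℓ c αs u ≡ 0
  matrixCount-¬fits {ℓ} {c} {αs} {u} ¬fits with all? (λ a → length (restrict a u) ≤? ℓ) αs
  ... | yes fits = ⊥-elim (¬fits fits)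
  ... | no _ = refl

  length-pad : ∀ ℓ L → length L ≤ ℓ → length (pad ℓ L) ≡ ℓ
  length-pad ℓ L L≤ℓ = trans (length-++ L {replicate (ℓ ∸ length L) 0})
    (trans (cong (length L +_) (length-replicate (ℓ ∸ length L) {0})) (m+[n∸m]≡n L≤ℓ))

  length-rowsOf : ∀ {ℓ u α} → Fits ℓ u α → ∀ {r} → r ∈ rowsOf ℓ u α → length r ≡ ℓ
  length-rowsOf {ℓ} {u} {α} fits r∈ =
    trans (↭-length (∈-rearrangements⁻ (pad ℓ (restrict α u)) r∈)) (length-pad ℓ (restrict α u) fits)

  length-colSums : ∀ ℓ {M} → All (λ r → length r ≡ ℓ) M → length (colSums ℓ M) ≡ ℓ
  length-colSums ℓ [] = length-replicate ℓ
  length-colSums ℓ {r ∷ M} (len ∷ lens) =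
    trans (length-zipWith _+_ r (colSums ℓ M)) (trans (cong₂ _⊓_ len (length-colSums ℓ lens)) (⊓-idem ℓ))

  +-split : ∀ {a b c} → zipWith _+_ a b ≡ c → length a ≡ length c → length b ≡ length c →
    Pointwise _≤_ a c × b ≡ zipWith _∸_ c a
  +-split {[]} {[]} {[]} _ _ _ = [] , refl
  +-split {x ∷ a} {y ∷ b} {z ∷ c} eq la lb with ∷-injective eq
  ... | refl , eq′ with +-split eq′ (suc-injective la) (suc-injective lb)
  ...   | a≤c , b≡ = (m≤m+n x y ∷ a≤c) , cong₂ _∷_ (sym (m+n∸m≡n x y)) b≡

  +-∸-cancel : ∀ {a c} → Pointwise _≤_ a c → zipWith _+_ a (zipWith _∸_ c a) ≡ c
  +-∸-cancel [] = refl
  +-∸-cancel (x≤z ∷ a≤c) = cong₂ _∷_ (m+[n∸m]≡n x≤z) (+-∸-cancel a≤c)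

  -- the number of ways to complete a first row to a matrix counted by matrixCount
  completions : ℕ → List ℕ → List StackPartition → ℕ → List ℕ → ℕ
  completions ℓ c αs u row with Pointwise.decidable _≤?_ row c
  ... | yes _ = matrixCount ℓ (zipWith _∸_ c row) αs u
  ... | no _ = 0

  matrixCount-∷ : ∀ {ℓ c α αs u} → Fits ℓ u α → length c ≡ ℓ →
    matrixCount ℓ c (α ∷ αs) u ≡ sum (map (completions ℓ c αs u) (rowsOf ℓ u α))
  matrixCount-∷ {ℓ} {c} {α} {αs} {u} fits len-c = split (all? (λ a → length (restrict a u) ≤? ℓ) αs)
    where
    split : Dec (All (Fits ℓ u) αs) → matrixCount ℓ c (α ∷ αs) u ≡ sum (map (completions ℓ c αs u) (rowsOf ℓ u α))
    split (no ¬fits) = trans (matrixCount-¬fits {ℓ} {c} {α ∷ αs} {u} (λ { (_ ∷ fits′) → ¬fits fits′ }))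
      (sym (Nat.∑-ε (rowsOf ℓ u α) (λ {row} _ → no-completions row)))
      where
      no-completions : ∀ row → completions ℓ c αs u row ≡ 0
      no-completions row with Pointwise.decidable _≤?_ row c
      ... | yes _ = matrixCount-¬fits {ℓ} {zipWith _∸_ c row} {αs} {u} ¬fits
      ... | no _ = refl
    split (yes fits′) = begin
      matrixCount ℓ c (α ∷ αs) u
        ≡⟨ matrixCount-fits {ℓ} {c} {α ∷ αs} {u} (fits ∷ fits′) ⟩
      sum (map (λ M → indicator (≡-dec _≟_ (colSums ℓ M) c)) (cartesianProductWith _∷_ (rowsOf ℓ u α) rest))
        ≡⟨ Nat.∑-cartesianProductWith _∷_ (λ M → indicator (≡-dec _≟_ (colSums ℓ M) c)) (rowsOf ℓ u α) rest ⟩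
      sum (map (λ row → sum (map (λ M → indicator (≡-dec _≟_ (colSums ℓ (row ∷ M)) c)) rest)) (rowsOf ℓ u α))
        ≡⟨ Nat.∑-cong (rowsOf ℓ u α) (λ {row} row∈ → first-row row (length-rowsOf {ℓ} {u} {α} fits row∈)) ⟩
      sum (map (completions ℓ c αs u) (rowsOf ℓ u α)) ∎
      where
      rest = choices (map (rowsOf ℓ u) αs)
      length-rest : ∀ {M} → M ∈ rest → length (colSums ℓ M) ≡ ℓ
      length-rest M∈ = length-colSums ℓ (lengths fits′ (∈-choices⁻ (map (rowsOf ℓ u) αs) M∈))
        where
        lengths : ∀ {βs M} → All (Fits ℓ u) βs → Pointwise _∈_ M (map (rowsOf ℓ u) βs) → All (λ r → length r ≡ ℓ) M
        lengths {[]} [] [] = []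
        lengths {β ∷ _} (f ∷ fs) (r∈ ∷ M∈) = length-rowsOf {ℓ} {u} {β} f r∈ ∷ lengths fs M∈
      first-row : ∀ row → length row ≡ ℓ →
        sum (map (λ M → indicator (≡-dec _≟_ (colSums ℓ (row ∷ M)) c)) rest) ≡ completions ℓ c αs u row
      first-row row len with Pointwise.decidable _≤?_ row c
      ... | no row≰c = Nat.∑-ε rest (λ M∈ → indicator-no _ (λ eq →
        row≰c (proj₁ (+-split eq (trans len (sym len-c)) (trans (length-rest M∈) (sym len-c))))))
      ... | yes row≤c = trans (Nat.∑-cong rest (λ {M} M∈ → indicator-cong _ (≡-dec _≟_ (colSums ℓ M) (zipWith _∸_ c row))
        (λ eq → proj₂ (+-split eq (trans len (sym len-c)) (trans (length-rest M∈) (sym len-c))))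
        (λ eq → trans (cong (zipWith _+_ row) eq) (+-∸-cancel row≤c))))
        (sym (matrixCount-fits {ℓ} {zipWith _∸_ c row} {αs} {u} fits′))

  completions-≤ : ∀ {ℓ c αs u row} → Pointwise _≤_ row c →
    completions ℓ c αs u row ≡ matrixCount ℓ (zipWith _∸_ c row) αs u
  completions-≤ {c = c} {row = row} row≤c with Pointwise.decidable _≤?_ row c
  ... | yes _ = refl
  ... | no row≰c = ⊥-elim (row≰c row≤c)

  completions-≰ : ∀ {ℓ c αs u row} → ¬ Pointwise _≤_ row c → completions ℓ c αs u row ≡ 0
  completions-≰ {c = c} {row = row} row≰c with Pointwise.decidable _≤?_ row c
  ... | yes row≤c = ⊥-elim (row≰c row≤c)
  ... | no _ = refl

  matrixCount-[] : ∀ ℓ c u → matrixCount ℓ c [] u ≡ indicator (≡-dec _≟_ (replicate ℓ 0) c)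
  matrixCount-[] ℓ c u = trans (length-filter≡∑indicator (λ M → ≡-dec _≟_ (colSums ℓ M) c) [ [] ]) (+-identityʳ _)

module Factors (N : ℕ) where

  open import Data.Nat using (zero; suc; _+_; _≤_; _<_; _≟_; z≤n; s≤s)
  open import Data.Nat.Properties using (suc-injective; <-trans; <-irrefl; <-cmp; <⇒≢; +-identityʳ)
  open import Data.Nat.ListAction using (sum)
  open import Data.Fin as Fin using (Fin)
  import Data.Fin.Properties as Fin
  open import Data.Product using (Σ; _×_; _,_; proj₁; proj₂; ∃-syntax)
  open import Data.Product.Properties using (≡-dec)
  open import Data.Sum using (_⊎_; inj₁; inj₂)
  open import Data.Empty using (⊥; ⊥-elim)
  open import Data.List using (List; []; _∷_; map; filter; length; lookup; _++_; replicate)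
  open import Data.List.Properties using (map-∘; map-++; length-++-sucʳ; map-cong-local; filter-accept; filter-reject)
  open import Data.List.Relation.Unary.All as All using (All; []; _∷_)
  open import Data.List.Relation.Unary.Any using (here; there)
  open import Data.List.Relation.Unary.AllPairs as AllPairs using (AllPairs; []; _∷_)
  import Data.List.Relation.Unary.AllPairs.Properties as AllPairs
  open import Data.List.Relation.Unary.Linked as Linked using (Linked; []; _∷_)
  open import Data.List.Relation.Unary.Linked.Properties using (Linked⇒AllPairs; AllPairs⇒Linked)
  open import Data.List.Relation.Unary.Unique.Propositional using (Unique)
  import Data.List.Relation.Unary.Unique.Propositional.Properties as Unique
  open import Data.List.Membership.Propositional using (_∈_; _∉_)
  open import Data.List.Membership.Propositional.Properties using (∈-map⁺; ∈-map⁻; ∈-∃++; ∈-filter⁻)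
  open import Data.List.Membership.Propositional.Properties.WithK using (unique∧set⇒bag)
  open import Data.List.Relation.Binary.BagAndSetEquality using (∼bag⇒↭)
  open import Data.List.Relation.Binary.Permutation.Propositional using (_↭_; ↭-refl; ↭-sym; ↭-trans; ↭-reflexive; prep; swap)
  open import Data.List.Relation.Binary.Permutation.Propositional.Properties as ↭ using (∈-resp-↭; All-resp-↭)
  open import Data.List.Relation.Binary.Pointwise using (Pointwise; []; _∷_)
  open import Data.Vec as Vec using (Vec)
  open import Function using (_∘_; mk⇔)
  open import Relation.Nullary using (Dec; yes; no; ¬_)
  open import Relation.Binary using (tri<; tri≈; tri>)
  open import Relation.Binary.PropositionalEquality using (_≡_; _≢_; refl; sym; trans; cong; cong₂; subst)
  open BigOperators using (module Nat; Unique-resp-↭; sorted-↭⇒≡; ∈-∷-remove)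
  open Stacks using (nonzero?; byDegree; restrict-pairs; restrict-nonzero; filter-nonzero-pad)

  -- (degree d, power m, index j) stands for the power x_{d,j}^m of a variable
  Factor : Set
  Factor = ℕ × ℕ × Fin N

  degree : Factor → ℕ
  degree = proj₁

  power : Factor → ℕ
  power = proj₁ ∘ proj₂

  index : Factor → Fin N
  index = proj₂ ∘ proj₂

  Var : Set
  Var = ℕ × Fin N

  var : Factor → Var
  var a = degree a , index a

  _≟ᵥ_ : (v w : Var) → Dec (v ≡ w)
  _≟ᵥ_ = ≡-dec _≟_ Fin._≟_

  stack : Factor → Stack
  stack a = degree a , power a

  -- a shape τ with an index vector v: the monomial ∏ₖ x_{dₖ,vₖ}^{mₖ} of M_τ
  Term : Set
  Term = Σ StackPartition (λ τ → Vec (Fin N) (length τ))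

  factors : Term → List Factor
  factors ([] , Vec.[]) = []
  factors ((d , m) ∷ τ , j Vec.∷ v) = (d , m , j) ∷ factors (τ , v)

  toTerm : List Factor → Term
  toTerm [] = [] , Vec.[]
  toTerm ((d , m , j) ∷ L) = ((d , m) ∷ proj₁ (toTerm L)) , (j Vec.∷ proj₂ (toTerm L))

  factors-toTerm : ∀ L → factors (toTerm L) ≡ L
  factors-toTerm [] = refl
  factors-toTerm (a ∷ L) = cong (a ∷_) (factors-toTerm L)

  toTerm-factors : ∀ t → toTerm (factors t) ≡ t
  toTerm-factors ([] , Vec.[]) = refl
  toTerm-factors ((d , m) ∷ τ , j Vec.∷ v) rewrite toTerm-factors (τ , v) = refl

  factors-injective : ∀ {t t′} → factors t ≡ factors t′ → t ≡ t′
  factors-injective {t} {t′} eq = trans (sym (toTerm-factors t)) (trans (cong toTerm eq) (toTerm-factors t′))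

  stacks-factors : ∀ t → map stack (factors t) ≡ proj₁ t
  stacks-factors ([] , Vec.[]) = refl
  stacks-factors ((d , m) ∷ τ , j Vec.∷ v) = cong ((d , m) ∷_) (stacks-factors (τ , v))

  -- e u i is the exponent of x_{u,i}
  Exponents : Set
  Exponents = ℕ → Fin N → ℕ

  exponent : Factor → Exponents
  exponent a u i with var a ≟ᵥ (u , i)
  ... | yes _ = power a
  ... | no _ = 0

  exponents : List Factor → Exponents
  exponents L u i = sum (map (λ a → exponent a u i) L)

  tupleExponents : List Term → Exponents
  tupleExponents [] u i = 0
  tupleExponents (t ∷ ts) u i = exponents (factors t) u i + tupleExponents ts u i

  exponent-var : ∀ a → exponent a (degree a) (index a) ≡ power a
  exponent-var a with var a ≟ᵥ var a
  ... | yes _ = refl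
  ... | no ≢ = ⊥-elim (≢ refl)

  exponent-≢ : ∀ a {u i} → var a ≢ (u , i) → exponent a u i ≡ 0
  exponent-≢ a {u} {i} ≢ with var a ≟ᵥ (u , i)
  ... | yes ≡ = ⊥-elim (≢ ≡)
  ... | no _ = refl

  exponents-++ : ∀ L L′ u i → exponents (L ++ L′) u i ≡ exponents L u i + exponents L′ u i
  exponents-++ L L′ u i = Nat.∑-++ (λ a → exponent a u i) L L′

  exponents-↭ : ∀ {L L′} → L ↭ L′ → ∀ u i → exponents L u i ≡ exponents L′ u i
  exponents-↭ L↭L′ u i = Nat.∑-↭ (λ a → exponent a u i) L↭L′

  exponents-∉ : ∀ L {u i} → (∀ {a} → a ∈ L → var a ≢ (u , i)) → exponents L u i ≡ 0
  exponents-∉ L ∉ = Nat.∑-ε L (λ a∈ → exponent-≢ _ (∉ a∈))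

  exponents≢0 : ∀ L {u i} → exponents L u i ≢ 0 → ∃[ a ] (a ∈ L × var a ≡ (u , i))
  exponents≢0 [] ≢0 = ⊥-elim (≢0 refl)
  exponents≢0 (a ∷ L) {u} {i} ≢0 with var a ≟ᵥ (u , i)
  ... | yes ≡ = a , here refl , ≡
  ... | no _ with exponents≢0 L ≢0
  ...   | b , b∈ , ≡ = b , there b∈ , ≡

  exponents-var : ∀ {L} → Unique (map var L) → ∀ {a} → a ∈ L → exponents L (degree a) (index a) ≡ power a
  exponents-var {b ∷ L} (b∉ ∷ _) (here refl) =
    trans (cong₂ _+_ (exponent-var b) (exponents-∉ L (λ c∈ eq → All.lookup b∉ (∈-map⁺ var c∈) (sym eq)))) (+-identityʳ _)
  exponents-var {b ∷ L} (b∉ ∷ u) (there a∈) =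
    trans (cong (_+ _) (exponent-≢ b (All.lookup b∉ (∈-map⁺ var a∈)))) (exponents-var u a∈)

  -- the order of the normal form: it refines _≥ₛ_ on stacks and orders equal stacks by increasing index,
  -- as Admissible demands
  _≻_ : Factor → Factor → Set
  a ≻ b = (degree b < degree a) ⊎ (degree a ≡ degree b × power b < power a)
        ⊎ (degree a ≡ degree b × power a ≡ power b × index a Fin.< index b)

  ≻-trans : ∀ {a b c} → a ≻ b → b ≻ c → a ≻ c
  ≻-trans (inj₁ x) (inj₁ y) = inj₁ (<-trans y x)
  ≻-trans (inj₁ x) (inj₂ (inj₁ (e , _))) = inj₁ (subst (_< _) e x)
  ≻-trans (inj₁ x) (inj₂ (inj₂ (e , _))) = inj₁ (subst (_< _) e x)
  ≻-trans (inj₂ (inj₁ (e , _))) (inj₁ y) = inj₁ (subst (_ <_) (sym e) y)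
  ≻-trans (inj₂ (inj₁ (e , x))) (inj₂ (inj₁ (e′ , y))) = inj₂ (inj₁ (trans e e′ , <-trans y x))
  ≻-trans (inj₂ (inj₁ (e , x))) (inj₂ (inj₂ (e′ , e″ , _))) = inj₂ (inj₁ (trans e e′ , subst (_< _) e″ x))
  ≻-trans (inj₂ (inj₂ (e , _))) (inj₁ y) = inj₁ (subst (_ <_) (sym e) y)
  ≻-trans (inj₂ (inj₂ (e , e₁ , _))) (inj₂ (inj₁ (e′ , y))) = inj₂ (inj₁ (trans e e′ , subst (_ <_) (sym e₁) y))
  ≻-trans (inj₂ (inj₂ (e , e₁ , x))) (inj₂ (inj₂ (e′ , e₁′ , y))) =
    inj₂ (inj₂ (trans e e′ , trans e₁ e₁′ , Fin.<-trans x y))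

  ≻-irrefl : ∀ {a} → ¬ (a ≻ a)
  ≻-irrefl (inj₁ x) = <-irrefl refl x
  ≻-irrefl (inj₂ (inj₁ (_ , x))) = <-irrefl refl x
  ≻-irrefl (inj₂ (inj₂ (_ , _ , x))) = Fin.<-irrefl refl x

  ≻-compare : ∀ a b → a ≻ b ⊎ a ≡ b ⊎ b ≻ a
  ≻-compare a b with <-cmp (degree a) (degree b)
  ... | tri< x _ _ = inj₂ (inj₂ (inj₁ x))
  ... | tri> _ _ x = inj₁ (inj₁ x)
  ... | tri≈ _ refl _ with <-cmp (power a) (power b)
  ...   | tri< x _ _ = inj₂ (inj₂ (inj₂ (inj₁ (refl , x))))
  ...   | tri> _ _ x = inj₁ (inj₂ (inj₁ (refl , x)))
  ...   | tri≈ _ refl _ with Fin.<-cmp (index a) (index b)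
  ...     | tri< x _ _ = inj₁ (inj₂ (inj₂ (refl , refl , x)))
  ...     | tri> _ _ x = inj₂ (inj₂ (inj₂ (inj₂ (refl , refl , x))))
  ...     | tri≈ _ refl _ = inj₂ (inj₁ refl)

  ≻-linked-unique : ∀ {L} → Linked _≻_ L → Unique L
  ≻-linked-unique = AllPairs.map (λ a≻b a≡b → ≻-irrefl (subst (_ ≻_) (sym a≡b) a≻b)) ∘ Linked⇒AllPairs ≻-trans

  ≻-sorted-members⇒≡ : ∀ {L L′} → Linked _≻_ L → Linked _≻_ L′ →
    (∀ {a} → a ∈ L → a ∈ L′) → (∀ {a} → a ∈ L′ → a ∈ L) → L ≡ L′
  ≻-sorted-members⇒≡ l l′ ⊆ ⊇ = sorted-↭⇒≡ ≻-trans (λ p q → ⊥-elim (≻-irrefl (≻-trans p q))) l l′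
    (∼bag⇒↭ (unique∧set⇒bag (≻-linked-unique l) (≻-linked-unique l′) (mk⇔ ⊆ ⊇)))

  Positive : Factor → Set
  Positive = PositiveStack ∘ stack

  record Normal (L : List Factor) : Set where
    field
      positive : All Positive L
      decreasing : Linked _≻_ L
      distinct : Unique (map var L)

  open Normal

  AgreeOn : List ℕ → Exponents → Exponents → Set
  AgreeOn us e e′ = All (λ u → ∀ i → e u i ≡ e′ u i) us

  DegreesIn : List ℕ → List Factor → Set
  DegreesIn us = All (λ a → degree a ∈ us)

  ∈-normal-agree : ∀ {us L L′} → Normal L → Normal L′ → DegreesIn us L → AgreeOn us (exponents L) (exponents L′) →
    ∀ {a} → a ∈ L → a ∈ L′
  ∈-normal-agree {us} {L} {L′} nL nL′ degs agree {a} a∈ = at-var-a (exponents≢0 L′ L′-at-a≢0)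
    where
    L′-at-a : exponents L′ (degree a) (index a) ≡ power a
    L′-at-a = trans (sym (All.lookup agree (All.lookup degs a∈) (index a))) (exponents-var (distinct nL) a∈)
    L′-at-a≢0 : exponents L′ (degree a) (index a) ≢ 0
    L′-at-a≢0 eq = <⇒≢ (proj₂ (All.lookup (positive nL) a∈)) (trans (sym eq) L′-at-a)
    at-var-a : ∃[ b ] (b ∈ L′ × var b ≡ var a) → a ∈ L′
    at-var-a (b , b∈ , refl) = subst (_∈ L′) (cong (λ m → degree a , m , index a)
      (trans (sym (exponents-var (distinct nL′) b∈)) L′-at-a)) b∈

  normal-agree⇒≡ : ∀ {us L L′} → Normal L → Normal L′ → DegreesIn us L → DegreesIn us L′ →
    AgreeOn us (exponents L) (exponents L′) → L ≡ L′
  normal-agree⇒≡ nL nL′ degs degs′ agree = ≻-sorted-members⇒≡ (decreasing nL) (decreasing nL′)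
    (∈-normal-agree nL nL′ degs agree) (∈-normal-agree nL′ nL degs′ (All.map (λ eq i → sym (eq i)) agree))

  insert : Factor → List Factor → List Factor
  insert a [] = a ∷ []
  insert a (b ∷ L) with ≻-compare a b
  ... | inj₂ (inj₂ _) = b ∷ insert a L
  ... | _ = a ∷ b ∷ L

  sort : List Factor → List Factor
  sort [] = []
  sort (a ∷ L) = insert a (sort L)

  insert-↭ : ∀ a L → insert a L ↭ a ∷ L
  insert-↭ a [] = ↭-refl
  insert-↭ a (b ∷ L) with ≻-compare a b
  ... | inj₁ _ = ↭-refl
  ... | inj₂ (inj₁ _) = ↭-refl
  ... | inj₂ (inj₂ _) = ↭-trans (prep b (insert-↭ a L)) (swap b a ↭-refl)

  sort-↭ : ∀ L → sort L ↭ L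
  sort-↭ [] = ↭-refl
  sort-↭ (a ∷ L) = ↭-trans (insert-↭ a (sort L)) (prep a (sort-↭ L))

  insert-sorted : ∀ a L → AllPairs _≻_ L → a ∉ L → AllPairs _≻_ (insert a L)
  insert-sorted a [] _ _ = [] ∷ []
  insert-sorted a (b ∷ L) (b≻L ∷ sorted) a∉ with ≻-compare a b
  ... | inj₁ a≻b = (a≻b ∷ All.map (≻-trans a≻b) b≻L) ∷ b≻L ∷ sorted
  ... | inj₂ (inj₁ refl) = ⊥-elim (a∉ (here refl))
  ... | inj₂ (inj₂ b≻a) = All-resp-↭ (↭-sym (insert-↭ a L)) (b≻a ∷ b≻L) ∷ insert-sorted a L sorted (a∉ ∘ there)

  sort-sorted : ∀ {L} → Unique L → AllPairs _≻_ (sort L)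
  sort-sorted {[]} _ = []
  sort-sorted {a ∷ L} (a∉ ∷ u) =
    insert-sorted a (sort L) (sort-sorted u) (λ a∈ → All.lookup a∉ (∈-resp-↭ (sort-↭ L) a∈) refl)

  sort-normal : ∀ {L} → All Positive L → Unique (map var L) → Normal (sort L)
  sort-normal {L} pos u = record
    { positive = All-resp-↭ (↭-sym (sort-↭ L)) pos
    ; decreasing = AllPairs⇒Linked (sort-sorted (Unique.map⁻ u))
    ; distinct = Unique-resp-↭ (↭.map⁺ var (↭-sym (sort-↭ L))) u
    }

  exponentRow-↭ : ∀ {u js} P → All (λ a → degree a ≡ u × index a ∈ js) P → Unique (map var P) → Unique js →
    (map (exponents P u) js ↭ pad (length js) (map power P)) × length (map power P) ≤ length js
  exponentRow-↭ {u} {js} [] _ _ _ = ↭-reflexive (zeros js) , z≤n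
    where
    zeros : ∀ is → map (exponents [] u) is ≡ replicate (length is) 0
    zeros [] = refl
    zeros (_ ∷ is) = cong (0 ∷_) (zeros is)
  exponentRow-↭ {js = js} (a ∷ P) ((refl , j∈) ∷ P-in) (a∉ ∷ uP) ujs with ∈-∃++ j∈
  ... | xs , ys , refl = ↭-trans (↭.map⁺ (exponents (a ∷ P) (degree a)) (↭.shift (index a) xs ys))
      (subst (_↭ pad (length js) (map power (a ∷ P))) (sym (cong₂ _∷_ at-a off-a))
        (subst (λ k → power a ∷ map (exponents P (degree a)) (xs ++ ys) ↭ pad k (map power (a ∷ P)))
          (sym (length-++-sucʳ xs (index a) ys)) (prep (power a) (proj₁ ih))))
    , subst (length (map power (a ∷ P)) ≤_) (sym (length-++-sucʳ xs (index a) ys)) (s≤s (proj₂ ih))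
    where
    u-rest : Unique (index a ∷ xs ++ ys)
    u-rest = Unique-resp-↭ (↭.shift (index a) xs ys) ujs
    var-a∉ : ∀ {b} → b ∈ P → var a ≢ var b
    var-a∉ b∈ = All.lookup a∉ (∈-map⁺ var b∈)
    ih = exponentRow-↭ {js = xs ++ ys} P
      (All.tabulate (λ {b} b∈ → let (deg-b , ib∈) = All.lookup P-in b∈ in
        deg-b , ∈-∷-remove xs ib∈ (λ ib≡ → var-a∉ b∈ (cong₂ _,_ (sym deg-b) (sym ib≡)))))
      uP (AllPairs.tail u-rest)
    at-a : exponents (a ∷ P) (degree a) (index a) ≡ power a
    at-a = exponents-var (a∉ ∷ uP) (here refl)
    off-a : map (exponents (a ∷ P) (degree a)) (xs ++ ys) ≡ map (exponents P (degree a)) (xs ++ ys)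
    off-a = map-cong-local (All.map (λ {i} i≢ → cong (_+ exponents P (degree a) i) (exponent-≢ a (i≢ ∘ cong proj₂)))
      (AllPairs.head u-rest))

  ofDegree : ℕ → List Factor → List Factor
  ofDegree u = filter (λ a → degree a ≟ u)

  exponents-ofDegree : ∀ L u i → exponents (ofDegree u L) u i ≡ exponents L u i
  exponents-ofDegree [] u i = refl
  exponents-ofDegree (a ∷ L) u i = by-degree (degree a ≟ u)
    where
    by-degree : Dec (degree a ≡ u) → exponents (ofDegree u (a ∷ L)) u i ≡ exponents (a ∷ L) u i
    by-degree (yes ≡u) = trans (cong (λ L′ → exponents L′ u i) (filter-accept (λ b → degree b ≟ u) ≡u))
      (cong (exponent a u i +_) (exponents-ofDegree L u i))
    by-degree (no ≢u) = trans (cong (λ L′ → exponents L′ u i) (filter-reject (λ b → degree b ≟ u) ≢u))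
      (trans (exponents-ofDegree L u i) (sym (cong (_+ exponents L u i) (exponent-≢ a (≢u ∘ cong proj₁)))))

  powers-ofDegree : ∀ t u → map power (ofDegree u (factors t)) ≡ restrict (proj₁ t) u
  powers-ofDegree ([] , Vec.[]) u = refl
  powers-ofDegree ((d , m) ∷ τ , j Vec.∷ v) u = by-degree (d ≟ u) (powers-ofDegree (τ , v) u)
    where
    by-degree : Dec (d ≡ u) → map power (ofDegree u (factors (τ , v))) ≡ restrict τ u →
      map power (ofDegree u (factors ((d , m) ∷ τ , j Vec.∷ v))) ≡ restrict ((d , m) ∷ τ) u
    by-degree (yes d≡u) ih = trans (cong (map power) (filter-accept (λ a → degree a ≟ u) {x = d , m , j} d≡u))
      (trans (cong (m ∷_) ih) (sym (cong (map mult) (filter-accept (λ s → deg s ≟ u) {x = d , m} d≡u))))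
    by-degree (no d≢u) ih = trans (cong (map power) (filter-reject (λ a → degree a ≟ u) {x = d , m , j} d≢u))
      (trans ih (sym (cong (map mult) (filter-reject (λ s → deg s ≟ u) {x = d , m} d≢u))))

  distinct-ofDegree : ∀ {L} u → Unique (map var L) → Unique (map var (ofDegree u L))
  distinct-ofDegree u uL = AllPairs.map⁺ (AllPairs.filter⁺ (λ a → degree a ≟ u) (AllPairs.map⁻ uL))

  degreeRow-↭ : ∀ {L} u {js} → Unique (map var L) → All (λ a → degree a ≡ u → index a ∈ js) L → Unique js →
    (map (exponents L u) js ↭ pad (length js) (map power (ofDegree u L))) × length (map power (ofDegree u L)) ≤ length js
  degreeRow-↭ {L} u {js} uL in-js ujs = subst (_↭ pad (length js) (map power (ofDegree u L))) (map-cong-local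
      (All.tabulate (λ {i} _ → exponents-ofDegree L u i))) (proj₁ row) , proj₂ row
    where
    row = exponentRow-↭ (ofDegree u L)
      (All.tabulate (λ a∈ → let (a∈L , deg-a) = ∈-filter⁻ (λ a → degree a ≟ u) a∈ in deg-a , All.lookup in-js a∈L deg-a))
      (distinct-ofDegree u uL) ujs

  indices-ofDegree-unique : ∀ {L} u → Unique (map var L) → Unique (map index (ofDegree u L))
  indices-ofDegree-unique {L} u uL = Unique.map⁻ (subst Unique
    (trans (map-cong-local (All.tabulate (λ a∈ → cong (_, _) (proj₂ (∈-filter⁻ (λ a → degree a ≟ u) {xs = L} a∈)))))
      (map-∘ (ofDegree u L)))
    (distinct-ofDegree u uL))

  rowFactors : ℕ → List (Fin N) → List ℕ → List Factor
  rowFactors u [] _ = []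
  rowFactors u (_ ∷ _) [] = []
  rowFactors u (j ∷ js) (zero ∷ r) = rowFactors u js r
  rowFactors u (j ∷ js) (suc μ ∷ r) = (u , suc μ , j) ∷ rowFactors u js r

  RowFactor : ℕ → List (Fin N) → Factor → Set
  RowFactor u js a = degree a ≡ u × index a ∈ js × 0 < power a

  rowFactors-RowFactor : ∀ u js r → All (RowFactor u js) (rowFactors u js r)
  rowFactors-RowFactor u [] _ = []
  rowFactors-RowFactor u (_ ∷ _) [] = []
  rowFactors-RowFactor u (j ∷ js) (zero ∷ r) = All.map (λ (d , i∈ , p) → d , there i∈ , p) (rowFactors-RowFactor u js r)
  rowFactors-RowFactor u (j ∷ js) (suc μ ∷ r) =
    (refl , here refl , s≤s z≤n) ∷ All.map (λ (d , i∈ , p) → d , there i∈ , p) (rowFactors-RowFactor u js r)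

  rowFactors-distinct : ∀ u js r → Unique js → Unique (map var (rowFactors u js r))
  rowFactors-distinct u [] _ _ = []
  rowFactors-distinct u (_ ∷ _) [] _ = []
  rowFactors-distinct u (j ∷ js) (zero ∷ r) (_ ∷ ujs) = rowFactors-distinct u js r ujs
  rowFactors-distinct u (j ∷ js) (suc μ ∷ r) (j∉ ∷ ujs) =
    All.map⁺ (All.map (λ (_ , i∈ , _) eq → All.lookup j∉ i∈ (cong proj₂ eq)) (rowFactors-RowFactor u js r))
    ∷ rowFactors-distinct u js r ujs
    where import Data.List.Relation.Unary.All.Properties as All

  exponents-rowFactors : ∀ u js r → Unique js → length r ≡ length js → map (exponents (rowFactors u js r) u) js ≡ r
  exponents-rowFactors u [] [] _ _ = refl
  exponents-rowFactors u (j ∷ js) (μ ∷ r) (j∉ ∷ ujs) len = cong₂ _∷_ (at-j μ) (trans (map-cong-local (All.map (off-j μ) j∉))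
    (exponents-rowFactors u js r ujs (suc-injective len)))
    where
    j∉-row : exponents (rowFactors u js r) u j ≡ 0
    j∉-row = exponents-∉ _ (λ a∈ eq → let (_ , i∈ , _) = All.lookup (rowFactors-RowFactor u js r) a∈ in
      All.lookup j∉ (subst (_∈ js) (cong proj₂ eq) i∈) refl)
    at-j : ∀ μ → exponents (rowFactors u (j ∷ js) (μ ∷ r)) u j ≡ μ
    at-j zero = j∉-row
    at-j (suc μ) = trans (cong₂ _+_ (exponent-var (u , suc μ , j)) j∉-row) (+-identityʳ _)
    off-j : ∀ μ {i} → j ≢ i → exponents (rowFactors u (j ∷ js) (μ ∷ r)) u i ≡ exponents (rowFactors u js r) u i
    off-j zero _ = refl
    off-j (suc μ) j≢i = cong (_+ _) (exponent-≢ (u , suc μ , j) (j≢i ∘ cong proj₂))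

  stacks-rowFactors : ∀ u js r → length r ≡ length js → map stack (rowFactors u js r) ≡ map (u ,_) (filter nonzero? r)
  stacks-rowFactors u [] [] _ = refl
  stacks-rowFactors u (j ∷ js) (zero ∷ r) len = stacks-rowFactors u js r (suc-injective len)
  stacks-rowFactors u (j ∷ js) (suc μ ∷ r) len = cong ((u , suc μ) ∷_) (stacks-rowFactors u js r (suc-injective len))

  module _ (J : ℕ → List (Fin N)) where

    rowsFactors : List ℕ → List (List ℕ) → List Factor
    rowsFactors [] _ = []
    rowsFactors (_ ∷ _) [] = []
    rowsFactors (u ∷ us) (r ∷ rs) = rowFactors u (J u) r ++ rowsFactors us rs

    RowsFactor : List ℕ → Factor → Set
    RowsFactor us a = degree a ∈ us × index a ∈ J (degree a) × 0 < power a

    rowsFactors-RowsFactor : ∀ us rs → All (RowsFactor us) (rowsFactors us rs)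
    rowsFactors-RowsFactor [] _ = []
    rowsFactors-RowsFactor (_ ∷ _) [] = []
    rowsFactors-RowsFactor (u ∷ us) (r ∷ rs) = All.++⁺
      (All.map (λ { (refl , i∈ , p) → here refl , i∈ , p }) (rowFactors-RowFactor u (J u) r))
      (All.map (λ (u∈ , i∈ , p) → there u∈ , i∈ , p) (rowsFactors-RowsFactor us rs))
      where import Data.List.Relation.Unary.All.Properties as All

    rowsFactors-distinct : ∀ {us} rs → Unique us → (∀ u → Unique (J u)) → Unique (map var (rowsFactors us rs))
    rowsFactors-distinct {[]} _ _ _ = []
    rowsFactors-distinct {_ ∷ _} [] _ _ = []
    rowsFactors-distinct {u ∷ us} (r ∷ rs) (u∉ ∷ uus) uJ rewrite map-++ var (rowFactors u (J u) r) (rowsFactors us rs) =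
      Unique.++⁺ (rowFactors-distinct u (J u) r (uJ u)) (rowsFactors-distinct rs uus uJ) disjoint
      where
      disjoint : ∀ {v} → v ∈ map var (rowFactors u (J u) r) × v ∈ map var (rowsFactors us rs) → ⊥
      disjoint (v∈ , v∈′) with ∈-map⁻ var v∈ | ∈-map⁻ var v∈′
      ... | a , a∈ , refl | b , b∈ , eq = All.lookup u∉ (proj₁ (All.lookup (rowsFactors-RowsFactor us rs) b∈))
        (trans (sym (proj₁ (All.lookup (rowFactors-RowFactor u (J u) r) a∈))) (cong proj₁ eq))

    exponents-rowsFactors-∉ : ∀ us rs {u i} → u ∉ us → exponents (rowsFactors us rs) u i ≡ 0
    exponents-rowsFactors-∉ us rs u∉ = exponents-∉ _ (λ a∈ eq →
      u∉ (subst (_∈ us) (cong proj₁ eq) (proj₁ (All.lookup (rowsFactors-RowsFactor us rs) a∈))))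

    exponents-rowsFactors : ∀ {us rs} → Unique us → (∀ u → Unique (J u)) → Pointwise (λ u r → length r ≡ length (J u)) us rs →
      map (λ u → map (exponents (rowsFactors us rs) u) (J u)) us ≡ rs
    exponents-rowsFactors _ _ [] = refl
    exponents-rowsFactors {u ∷ us} {r ∷ rs} (u∉ ∷ uus) uJ (len ∷ lens) = cong₂ _∷_
      (trans (map-cong-local (All.tabulate (λ {i} _ → trans (exponents-++ (rowFactors u (J u) r) _ u i)
          (trans (cong (_ +_) (exponents-rowsFactors-∉ us rs (λ u∈ → All.lookup u∉ u∈ refl))) (+-identityʳ _)))))
        (exponents-rowFactors u (J u) r (uJ u) len))
      (trans (map-cong-local (All.tabulate (λ {u′} u′∈ → map-cong-local (All.tabulate (λ {i} _ →
          trans (exponents-++ (rowFactors u (J u) r) _ u′ i) (cong (_+ _) (exponents-∉ _ (λ a∈ eq →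
            All.lookup u∉ u′∈ (trans (sym (proj₁ (All.lookup (rowFactors-RowFactor u (J u) r) a∈))) (cong proj₁ eq))))))))))
        (exponents-rowsFactors uus uJ lens))

  module _ (J : ℕ → List (Fin N)) {α : StackPartition} (pos : All PositiveStack α) where

    stacks-rowFactors-↭ : ∀ u r → r ↭ pad (length (J u)) (restrict α u) → length r ≡ length (J u) →
      map stack (rowFactors u (J u) r) ↭ filter (λ s → deg s ≟ u) α
    stacks-rowFactors-↭ u r r↭ len = subst (map stack (rowFactors u (J u) r) ↭_)
      (trans (cong (map (u ,_)) (filter-nonzero-pad (length (J u)) (restrict-nonzero u pos))) (restrict-pairs u α))
      (subst (_↭ _) (sym (stacks-rowFactors u (J u) r len)) (↭.map⁺ (u ,_) (↭.filter-↭ nonzero? r↭)))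

    stacks-rowsFactors-↭ : ∀ {us rs} →
      Pointwise (λ u r → r ↭ pad (length (J u)) (restrict α u) × length r ≡ length (J u)) us rs →
      map stack (rowsFactors J us rs) ↭ byDegree us α
    stacks-rowsFactors-↭ [] = ↭-refl
    stacks-rowsFactors-↭ {u ∷ _} {r ∷ rs} ((r↭ , len) ∷ rows) = subst (_↭ _) (sym (map-++ stack (rowFactors u (J u) r) _))
      (↭.++⁺ (stacks-rowFactors-↭ u r r↭ len) (stacks-rowsFactors-↭ rows))

module Terms {c ℓ} (R : CommutativeSemiring c ℓ) (N : ℕ) where

  open import Data.Nat using (s≤s; z≤n; _≤_)
  open import Data.Nat.Properties using (<⇒≤; ≤-reflexive; m≤n⇒m<n∨m≡n; <⇒≢)
  open import Data.Fin as Fin using (Fin)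
  import Data.Fin.Properties as Fin
  open import Data.Product using (_×_; _,_; proj₁; proj₂)
  open import Data.Sum using (inj₁; inj₂)
  open import Data.Empty using (⊥-elim)
  open import Data.List using (List; []; _∷_; map; length; lookup; tabulate)
  open import Data.List.Relation.Unary.All as All using (All; []; _∷_)
  import Data.List.Relation.Unary.All.Properties as All
  open import Data.List.Relation.Unary.AllPairs as AllPairs using (AllPairs; []; _∷_)
  import Data.List.Relation.Unary.AllPairs.Properties as AllPairs
  open import Data.List.Relation.Unary.Linked as Linked using (Linked; []; [-]; _∷_)
  open import Data.List.Relation.Unary.Linked.Properties using (Linked⇒AllPairs)
  open import Data.List.Relation.Unary.Unique.Propositional using (Unique)
  open import Data.List.Relation.Binary.Pointwise using (Pointwise)
  open import Data.List.Relation.Binary.Permutation.Propositional using (_↭_; ↭-sym)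
  open import Data.List.Relation.Binary.Permutation.Propositional.Properties using (All-resp-↭)
  open import Data.List.Properties using (map-cong-local)
  import Data.List.Relation.Unary.Linked.Properties as Linked
  open import Data.Vec as Vec using (Vec)
  open import Function using (_∘_)
  open import Relation.Binary.PropositionalEquality using (_≡_; _≢_; refl; sym; trans; cong; cong₂; subst)
  open Factors N

  open Eval R using (Admissible)

  -- Admissible, stated for one pair of factors
  Compatible : Factor → Factor → Set
  Compatible a b = (degree a ≡ degree b → index a ≢ index b) × (degree a ≡ degree b → power a ≡ power b → index a Fin.< index b)

  factorAt : (t : Term) → Fin (length (proj₁ t)) → Factor
  factorAt (τ , v) k = deg (lookup τ k) , mult (lookup τ k) , Vec.lookup v k

  All-factors⁺ : ∀ {P : Factor → Set} t → (∀ k → P (factorAt t k)) → All P (factors t)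
  All-factors⁺ ([] , Vec.[]) _ = []
  All-factors⁺ (_ ∷ τ , _ Vec.∷ v) P-at = P-at Fin.zero ∷ All-factors⁺ (τ , v) (P-at ∘ Fin.suc)

  All-factors⁻ : ∀ {P : Factor → Set} t → All P (factors t) → ∀ k → P (factorAt t k)
  All-factors⁻ (_ ∷ τ , _ Vec.∷ v) (p ∷ _) Fin.zero = p
  All-factors⁻ (_ ∷ τ , _ Vec.∷ v) (_ ∷ ps) (Fin.suc k) = All-factors⁻ (τ , v) ps k

  admissible⇒compatible : ∀ τ v → Admissible τ v → AllPairs Compatible (factors (τ , v))
  admissible⇒compatible [] Vec.[] _ = []
  admissible⇒compatible (_ ∷ τ) (_ Vec.∷ v) adm =
    All-factors⁺ (τ , v) (λ k → proj₁ (adm Fin.zero (Fin.suc k)) (λ ()) , proj₂ (adm Fin.zero (Fin.suc k)) (s≤s z≤n))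
    ∷ admissible⇒compatible τ v (λ k k′ → (λ k≢k′ → proj₁ (adm (Fin.suc k) (Fin.suc k′)) (k≢k′ ∘ Fin.suc-injective)) ,
                                          (proj₂ (adm (Fin.suc k) (Fin.suc k′)) ∘ s≤s))

  compatible⇒admissible : ∀ τ v → AllPairs Compatible (factors (τ , v)) → Admissible τ v
  compatible⇒admissible (_ ∷ τ) (_ Vec.∷ v) (_ ∷ _) Fin.zero Fin.zero = (λ 0≢0 → ⊥-elim (0≢0 refl)) , λ ()
  compatible⇒admissible (_ ∷ τ) (_ Vec.∷ v) (head ∷ _) Fin.zero (Fin.suc k′) =
    (λ _ → proj₁ (All-factors⁻ (τ , v) head k′)) , (λ _ → proj₂ (All-factors⁻ (τ , v) head k′))
  compatible⇒admissible (_ ∷ τ) (_ Vec.∷ v) (head ∷ _) (Fin.suc k) Fin.zero =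
    (λ _ d≡ j≡ → proj₁ (All-factors⁻ (τ , v) head k) (sym d≡) (sym j≡)) , λ ()
  compatible⇒admissible (_ ∷ τ) (_ Vec.∷ v) (_ ∷ tail) (Fin.suc k) (Fin.suc k′) =
    (λ k≢k′ → proj₁ (compatible⇒admissible τ v tail k k′) (k≢k′ ∘ cong Fin.suc)) ,
    (λ { (s≤s k<k′) → proj₂ (compatible⇒admissible τ v tail k k′) k<k′ })

  ValidTerm : Term → Set
  ValidTerm (τ , v) = IsStackPartition τ × Admissible τ v

  ≻⇒≥ₛ : ∀ {a b} → a ≻ b → stack a ≥ₛ stack b
  ≻⇒≥ₛ (inj₁ x) = inj₁ x
  ≻⇒≥ₛ (inj₂ (inj₁ (e , x))) = inj₂ (e , <⇒≤ x)
  ≻⇒≥ₛ (inj₂ (inj₂ (e , e′ , _))) = inj₂ (e , ≤-reflexive (sym e′))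

  ≥ₛ∧compatible⇒≻ : ∀ {a b} → stack a ≥ₛ stack b → Compatible a b → a ≻ b
  ≥ₛ∧compatible⇒≻ (inj₁ x) _ = inj₁ x
  ≥ₛ∧compatible⇒≻ (inj₂ (e , le)) (_ , ordered) with m≤n⇒m<n∨m≡n le
  ... | inj₁ lt = inj₂ (inj₁ (e , lt))
  ... | inj₂ refl = inj₂ (inj₂ (e , refl , ordered e refl))

  ≻∧distinct⇒compatible : ∀ {a b} → a ≻ b → var a ≢ var b → Compatible a b
  ≻∧distinct⇒compatible {a} {b} a≻b a≢b = (λ d≡ j≡ → a≢b (cong₂ _,_ d≡ j≡)) , ordered a≻b
    where
    ordered : a ≻ b → degree a ≡ degree b → power a ≡ power b → index a Fin.< index b
    ordered (inj₁ x) d≡ _ = ⊥-elim (<⇒≢ x (sym d≡))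
    ordered (inj₂ (inj₁ (_ , x))) _ p≡ = ⊥-elim (<⇒≢ x (sym p≡))
    ordered (inj₂ (inj₂ (_ , _ , x))) _ _ = x

  valid⇒normal : ∀ t → ValidTerm t → Normal (factors t)
  valid⇒normal t@(τ , v) ((pos , sorted) , adm) = record
    { positive = All.map⁻ (subst (All PositiveStack) (sym (stacks-factors t)) pos)
    ; decreasing = linked (subst (Linked _≥ₛ_) (sym (stacks-factors t)) sorted) (admissible⇒compatible τ v adm)
    ; distinct = AllPairs.map⁺ (AllPairs.map (λ (≢ , _) eq → ≢ (cong proj₁ eq) (cong proj₂ eq)) (admissible⇒compatible τ v adm))
    }
    where
    linked : ∀ {L} → Linked _≥ₛ_ (map stack L) → AllPairs Compatible L → Linked _≻_ L
    linked {[]} _ _ = []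
    linked {_ ∷ []} _ _ = [-]
    linked {_ ∷ _ ∷ _} (a≥b ∷ l) ((ab ∷ _) ∷ cs) = ≥ₛ∧compatible⇒≻ a≥b ab ∷ linked l cs

  normal⇒valid : ∀ L → Normal L → ValidTerm (toTerm L)
  normal⇒valid L nL =
    (subst (All PositiveStack) stacks (All.map⁺ (subst (All Positive) L≡ (Normal.positive nL))) ,
     subst (Linked _≥ₛ_) stacks (Linked.map⁺ (Linked.map ≻⇒≥ₛ (subst (Linked _≻_) L≡ (Normal.decreasing nL))))) ,
    compatible⇒admissible (proj₁ (toTerm L)) (proj₂ (toTerm L)) (subst (AllPairs Compatible) L≡
      (AllPairs.zipWith (λ (a≻b , a≢b) → ≻∧distinct⇒compatible a≻b a≢b)
        (Linked⇒AllPairs ≻-trans (Normal.decreasing nL) , AllPairs.map⁻ (Normal.distinct nL))))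
    where
    L≡ : L ≡ factors (toTerm L)
    L≡ = sym (factors-toTerm L)
    stacks : map stack (factors (toTerm L)) ≡ proj₁ (toTerm L)
    stacks = stacks-factors (toTerm L)

  module FromRows (J : ℕ → List (Fin N)) (J-unique : ∀ u → Unique (J u))
                  {us : List ℕ} (us-unique : Unique us) (us-positive : All (1 ≤_) us) where

    rowsTerm : List (List ℕ) → Term
    rowsTerm rs = toTerm (sort (rowsFactors J us rs))

    factors-rowsTerm-↭ : ∀ rs → factors (rowsTerm rs) ↭ rowsFactors J us rs
    factors-rowsTerm-↭ rs = subst (_↭ rowsFactors J us rs) (sym (factors-toTerm _)) (sort-↭ _)

    rowsTerm-valid : ∀ rs → ValidTerm (rowsTerm rs)
    rowsTerm-valid rs = normal⇒valid _ (sort-normal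
      (All.map (λ (u∈ , _ , 0<p) → All.lookup us-positive u∈ , 0<p) (rowsFactors-RowsFactor J us rs))
      (rowsFactors-distinct J rs us-unique J-unique))

    rowsTerm-RowsFactor : ∀ rs → All (RowsFactor J us) (factors (rowsTerm rs))
    rowsTerm-RowsFactor rs = All-resp-↭ (↭-sym (factors-rowsTerm-↭ rs)) (rowsFactors-RowsFactor J us rs)

    exponents-rowsTerm : ∀ {rs} → Pointwise (λ u r → length r ≡ length (J u)) us rs →
      map (λ u → map (exponents (factors (rowsTerm rs)) u) (J u)) us ≡ rs
    exponents-rowsTerm {rs} lens = trans
      (map-cong-local (All.tabulate (λ {u} _ → map-cong-local (All.tabulate (λ {i} _ → exponents-↭ (factors-rowsTerm-↭ rs) u i)))))
      (exponents-rowsFactors J us-unique J-unique lens)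

  tabulate-factorAt : ∀ t → tabulate (factorAt t) ≡ factors t
  tabulate-factorAt ([] , Vec.[]) = refl
  tabulate-factorAt (s ∷ τ , j Vec.∷ v) = cong (_ ∷_) (tabulate-factorAt (τ , v))

module Counting {c ℓ} (R : CommutativeSemiring c ℓ) (N : ℕ) where

  open import Data.Nat using (_+_; _∸_; _≤_; _≟_; _≤?_; z≤n)
  open import Data.Nat.Properties using (m+n∸m≡n; m+[n∸m]≡n; m≤m+n; <⇒≢; ≤-trans; 0∸n≡0; +-identityʳ)
  open import Data.Nat.ListAction using (sum; product)
  open import Data.Fin using (Fin)
  import Data.Fin.Properties as Fin
  open import Data.Product using (Σ; _×_; _,_; proj₁; proj₂; ∃-syntax)
  open import Data.Product.Properties.WithK using (,-injectiveʳ)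
  open import Data.Empty using (⊥-elim)
  open import Data.List using (List; []; _∷_; [_]; map; filter; length; replicate; zipWith; cartesianProductWith)
  open import Data.List.Properties using (map-cong-local; length-map; ≡-dec)
  open import Data.List.Relation.Unary.All as All using (All; []; _∷_; all?)
  open import Data.List.Relation.Unary.All.Properties using (¬All⇒Any¬)
  import Data.List.Relation.Unary.All.Properties as All
  open import Data.List.Relation.Unary.Any using (here; there)
  open import Data.List.Relation.Unary.Unique.Propositional using (Unique)
  import Data.List.Relation.Unary.Unique.Propositional.Properties as Unique
  open import Data.List.Relation.Binary.Pointwise as Pointwise using (Pointwise; []; _∷_)
  open import Data.List.Membership.Propositional using (_∈_; _∉_; find)
  open import Data.List.Membership.Propositional.Properties using (∈-filter⁺; ∈-filter⁻; ∈-cartesianProductWith⁻)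
  open import Data.List.Membership.DecPropositional (Fin._≟_ {N}) using (_∈?_)
  open import Data.List.Relation.Binary.Permutation.Propositional using (_↭_; ↭-trans)
  import Data.List.Relation.Binary.Permutation.Propositional.Properties as ↭
  open import Data.Vec using (Vec)
  open import Function using (_∘_)
  open import Relation.Nullary using (Dec; yes; no; ¬_)
  open import Relation.Binary.PropositionalEquality using (_≡_; _≢_; refl; sym; trans; cong; subst)
  open Relation.Binary.PropositionalEquality.≡-Reasoning
  open BigOperators
  open Enumerations
  open Factors N
  open Terms R N
  open Matrices
  open Stacks using (≥ₛ-trans; ≥ₛ-antisym; byDegree-↭)

  open Eval R using (allVecs; admissible?)

  admissibleVecs : (α : StackPartition) → List (Vec (Fin N) (length α))
  admissibleVecs α = filter (admissible? α) (allVecs N (length α))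

  tuples : List StackPartition → List (List Term)
  tuples [] = [ [] ]
  tuples (α ∷ αs) = cartesianProductWith (λ v ts → (α , v) ∷ ts) (admissibleVecs α) (tuples αs)

  ∈-tuples⁻ : ∀ βs {ts} → ts ∈ tuples βs → map proj₁ ts ≡ βs × All (λ t → proj₂ t ∈ admissibleVecs (proj₁ t)) ts
  ∈-tuples⁻ [] (here refl) = refl , []
  ∈-tuples⁻ (β ∷ βs) ts∈ with ∈-cartesianProductWith⁻ (λ v ts → (β , v) ∷ ts) (admissibleVecs β) (tuples βs) ts∈
  ... | v , ts , v∈ , ts∈′ , refl = cong (β ∷_) (proj₁ (∈-tuples⁻ βs ts∈′)) , v∈ ∷ proj₂ (∈-tuples⁻ βs ts∈′)

  agree? : ∀ us e e′ → Dec (AgreeOn us e e′)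
  agree? us e e′ = all? (λ u → Fin.all? (λ i → e u i ≟ e′ u i)) us

  admissibleVecs-normal : ∀ {α v} → IsStackPartition α → v ∈ admissibleVecs α → Normal (factors (α , v))
  admissibleVecs-normal {α} sp v∈ = valid⇒normal (α , _) (sp , proj₂ (∈-filter⁻ (admissible? α) {xs = allVecs N (length α)} v∈))

  degreesIn-factors : ∀ {us} t → All (λ s → deg s ∈ us) (proj₁ t) → DegreesIn us (factors t)
  degreesIn-factors t degs = All.map⁻ (subst (All _) (sym (stacks-factors t)) degs)

  -- J u lists the indices i of the variables x_{u,i} that the monomials counted may use
  module TupleCount (K : ℕ) (J : ℕ → List (Fin N)) (J-unique : ∀ u → Unique (J u)) where

    us : List ℕ
    us = range1 K

    width : ℕ → ℕ
    width u = length (J u)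

    column : Exponents → ℕ → List ℕ
    column m u = map (m u) (J u)

    SupportedOn : Exponents → Set
    SupportedOn m = ∀ {u} → u ∈ us → ∀ i → m u i ≢ 0 → i ∈ J u

    InJ : List Factor → Set
    InJ = All (λ a → index a ∈ J (degree a))

    Bounded : StackPartition → Set
    Bounded α = IsStackPartition α × All (λ s → deg s ∈ us) α

    supportedVecs : (α : StackPartition) → List (Vec (Fin N) (length α))
    supportedVecs α = filter (λ v → all? (λ a → index a ∈? J (degree a)) (factors (α , v))) (admissibleVecs α)

    exponentMatrix : (α : StackPartition) → Vec (Fin N) (length α) → List (List ℕ)
    exponentMatrix α v = map (column (exponents (factors (α , v)))) us

    rowChoices : StackPartition → List (List (List ℕ))
    rowChoices α = choices (map (λ u → rowsOf (width u) u α) us)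

    tupleCount : List StackPartition → Exponents → ℕ
    tupleCount αs m = sum (map (λ ts → indicator (agree? us (tupleExponents ts) m)) (tuples αs))

    columnCount : List StackPartition → Exponents → ℕ
    columnCount αs m = product (map (λ u → matrixCount (width u) (column m u) αs u) us)

    ∈-supportedVecs⁻ : ∀ {α v} → v ∈ supportedVecs α → v ∈ admissibleVecs α × InJ (factors (α , v))
    ∈-supportedVecs⁻ {α} = ∈-filter⁻ (λ v → all? (λ a → index a ∈? J (degree a)) (factors (α , v))) {xs = admissibleVecs α}

    exponents-outside : ∀ {L u i} → InJ L → i ∉ J u → exponents L u i ≡ 0
    exponents-outside {L} inJ i∉ = exponents-∉ L (λ a∈ → λ { refl → i∉ (All.lookup inJ a∈) })

    column-↭ : ∀ {α v} → Normal (factors (α , v)) → InJ (factors (α , v)) → ∀ u →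
      column (exponents (factors (α , v))) u ↭ pad (width u) (restrict α u) × Fits (width u) u α
    column-↭ {α} {v} nf inJ u =
      subst (λ r → column (exponents (factors (α , v))) u ↭ pad (width u) r × length r ≤ width u) (powers-ofDegree (α , v) u)
        (degreeRow-↭ u (Normal.distinct nf) (All.map (λ i∈ → λ { refl → i∈ }) inJ) (J-unique u))

    supportedVecs-normal : ∀ {α v} → IsStackPartition α → v ∈ supportedVecs α → Normal (factors (α , v))
    supportedVecs-normal {α} sp v∈ = admissibleVecs-normal sp (proj₁ (∈-supportedVecs⁻ {α} v∈))

    supportedVecs-column-↭ : ∀ {α v} → IsStackPartition α → v ∈ supportedVecs α → ∀ u →
      column (exponents (factors (α , v))) u ↭ pad (width u) (restrict α u) × Fits (width u) u α
    supportedVecs-column-↭ {α} {v} sp v∈ =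
      column-↭ {α} {v} (supportedVecs-normal {α} sp v∈) (proj₂ (∈-supportedVecs⁻ {α} v∈))

    exponentMatrix-injective : ∀ {α} → Bounded α → ∀ {v v′} → v ∈ supportedVecs α → v′ ∈ supportedVecs α →
      exponentMatrix α v ≡ exponentMatrix α v′ → v ≡ v′
    exponentMatrix-injective {α} (sp , degs) {v} {v′} v∈ v′∈ eq = ,-injectiveʳ (factors-injective
      (normal-agree⇒≡ (supportedVecs-normal {α} sp v∈) (supportedVecs-normal {α} sp v′∈)
        (degreesIn-factors (α , v) degs) (degreesIn-factors (α , v′) degs) (All.tabulate agree)))
      where
      agree : ∀ {u} → u ∈ us → ∀ i → exponents (factors (α , v)) u i ≡ exponents (factors (α , v′)) u i
      agree {u} u∈ i with i ∈? J u
      ... | yes i∈ = map-≡⇒≡ (map-≡⇒≡ eq u∈) i∈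
      ... | no i∉ = trans (exponents-outside (proj₂ (∈-supportedVecs⁻ {α} v∈)) i∉)
                          (sym (exponents-outside (proj₂ (∈-supportedVecs⁻ {α} v′∈)) i∉))

    exponentMatrix∈rowChoices : ∀ {α} → IsStackPartition α → ∀ {v} → v ∈ supportedVecs α →
      exponentMatrix α v ∈ rowChoices α
    exponentMatrix∈rowChoices {α} sp {v} v∈ = ∈-choices⁺ (rows us)
      where
      rows : ∀ vs → Pointwise _∈_ (map (column (exponents (factors (α , v)))) vs) (map (λ u → rowsOf (width u) u α) vs)
      rows [] = []
      rows (u ∷ vs) = ∈-rearrangements⁺ _ (proj₁ (supportedVecs-column-↭ {α} {v} sp v∈ u)) ∷ rows vs

    open FromRows J J-unique (range1-unique K) (All.tabulate ∈-range1⁻)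

    exponentMatrix-onto : ∀ {α} → Bounded α → All (λ u → Fits (width u) u α) us → ∀ {M} → M ∈ rowChoices α →
      ∃[ v ] (v ∈ supportedVecs α × exponentMatrix α v ≡ M)
    exponentMatrix-onto {α} (sp , degs) fits {M} M∈ = v , v∈ , matrix≡
      where
      rows : ∀ {vs M} → All (λ u → Fits (width u) u α) vs → Pointwise _∈_ M (map (λ u → rowsOf (width u) u α) vs) →
        Pointwise (λ u r → r ↭ pad (width u) (restrict α u) × length r ≡ width u) vs M
      rows {[]} [] [] = []
      rows {u ∷ _} (fit ∷ fits) (r∈ ∷ rs∈) =
        (∈-rearrangements⁻ _ r∈ , length-rowsOf {width u} {u} {α} fit r∈) ∷ rows fits rs∈
      M-rows = rows fits (∈-choices⁻ (map (λ u → rowsOf (width u) u α) us) M∈)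
      t = rowsTerm M
      shape : proj₁ t ≡ α
      shape = sorted-↭⇒≡ ≥ₛ-trans ≥ₛ-antisym (proj₂ (proj₁ (rowsTerm-valid M))) (proj₂ sp)
        (subst (_↭ α) (stacks-factors t) (↭-trans (↭.map⁺ stack (factors-rowsTerm-↭ M))
          (↭-trans (stacks-rowsFactors-↭ J (proj₁ sp) M-rows) (byDegree-↭ α (range1-unique K) degs))))
      with-shape : ∀ (t : Term) → proj₁ t ≡ α → Σ (Vec (Fin N) (length α)) (λ v → t ≡ (α , v))
      with-shape (_ , v) refl = v , refl
      v = proj₁ (with-shape t shape)
      t≡ = proj₂ (with-shape t shape)
      v∈ : v ∈ supportedVecs α
      v∈ = ∈-filter⁺ _ (∈-filter⁺ (admissible? α) (∈-allVecs R N v) (proj₂ (subst ValidTerm t≡ (rowsTerm-valid M))))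
        (All.map (λ (_ , i∈ , _) → i∈) (subst (All (RowsFactor J us) ∘ factors) t≡ (rowsTerm-RowsFactor M)))
      matrix≡ : exponentMatrix α v ≡ M
      matrix≡ = subst (λ t → map (column (exponents (factors t))) us ≡ M) t≡ (exponents-rowsTerm (Pointwise.map proj₂ M-rows))

    replicate≡map-0 : ∀ (js : List (Fin N)) → replicate (length js) 0 ≡ map (λ _ → 0) js
    replicate≡map-0 [] = refl
    replicate≡map-0 (_ ∷ js) = cong (0 ∷_) (replicate≡map-0 js)

    tupleCount-[] : ∀ m → SupportedOn m → tupleCount [] m ≡ columnCount [] m
    tupleCount-[] m supp = begin
      indicator (agree? us (λ _ _ → 0) m) + 0
        ≡⟨ +-identityʳ _ ⟩
      indicator (agree? us (λ _ _ → 0) m)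
        ≡⟨ indicator-cong _ (all? zero-column? us) (All.map to) (All.tabulate ∘ from) ⟩
      indicator (all? zero-column? us)
        ≡⟨ ∏indicator≡indicator-all zero-column? us ⟨
      product (map (indicator ∘ zero-column?) us)
        ≡⟨ cong product (map-cong-local {xs = us} (All.tabulate (λ {u} _ → matrixCount-[] (width u) (column m u) u))) ⟨
      columnCount [] m ∎
      where
      zero-column? : ∀ u → Dec (replicate (width u) 0 ≡ column m u)
      zero-column? u = ≡-dec _≟_ (replicate (width u) 0) (column m u)
      to : ∀ {u} → (∀ i → 0 ≡ m u i) → replicate (width u) 0 ≡ column m u
      to {u} 0≡m = trans (replicate≡map-0 (J u)) (map-cong-local (All.tabulate (λ {i} _ → 0≡m i)))
      from : All (λ u → replicate (width u) 0 ≡ column m u) us → ∀ {u} → u ∈ us → ∀ i → 0 ≡ m u i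
      from zeros {u} u∈ i with m u i ≟ 0
      ... | yes m≡0 = sym m≡0
      ... | no m≢0 = map-≡⇒≡ (trans (sym (replicate≡map-0 (J u))) (All.lookup zeros u∈)) (supp u∈ i m≢0)

    extensions : ∀ α → List StackPartition → Exponents → Vec (Fin N) (length α) → ℕ
    extensions α αs m v = sum (map (λ ts → indicator (agree? us (tupleExponents ((α , v) ∷ ts)) m)) (tuples αs))

    completionCount : Exponents → List StackPartition → List (List ℕ) → ℕ
    completionCount m αs M = product (zipWith (λ u r → completions (width u) (column m u) αs u r) us M)

    tupleCount-∷ : ∀ α αs m → tupleCount (α ∷ αs) m ≡ sum (map (extensions α αs m) (admissibleVecs α))
    tupleCount-∷ α αs m = Nat.∑-cartesianProductWith (λ v ts → (α , v) ∷ ts)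
      (λ ts → indicator (agree? us (tupleExponents ts) m)) (admissibleVecs α) (tuples αs)

    extensions-outside : ∀ {α αs m v} → Bounded α → SupportedOn m → v ∈ admissibleVecs α → ¬ InJ (factors (α , v)) →
      extensions α αs m v ≡ 0
    extensions-outside {α} {αs} {m} {v} (sp , degs) supp v∈ ¬inJ
      with find (¬All⇒Any¬ (λ a → index a ∈? J (degree a)) (factors (α , v)) ¬inJ)
    ... | a , a∈ , i∉ = Nat.∑-ε (tuples αs) (λ {ts} _ → indicator-no _ (disagree {ts}))
      where
      nf = admissibleVecs-normal sp v∈
      u∈ = All.lookup (degreesIn-factors (α , v) degs) a∈
      m≡0 : m (degree a) (index a) ≡ 0
      m≡0 with m (degree a) (index a) ≟ 0
      ... | yes m≡0 = m≡0
      ... | no m≢0 = ⊥-elim (i∉ (supp u∈ (index a) m≢0))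
      disagree : ∀ {ts} → ¬ AgreeOn us (tupleExponents ((α , v) ∷ ts)) m
      disagree {ts} agree = <⇒≢ (≤-trans (proj₂ (All.lookup (Normal.positive nf) a∈)) (m≤m+n _ (tupleExponents ts _ _)))
        (sym (trans (cong (_+ tupleExponents ts _ _) (sym (exponents-var (Normal.distinct nf) a∈)))
          (trans (All.lookup agree u∈ (index a)) m≡0)))

    Pointwise-column⁻ : ∀ {f g : Fin N → ℕ} js → Pointwise _≤_ (map f js) (map g js) → ∀ {i} → i ∈ js → f i ≤ g i
    Pointwise-column⁻ (_ ∷ _) (f≤g ∷ _) (here refl) = f≤g
    Pointwise-column⁻ (_ ∷ js) (_ ∷ fs≤gs) (there i∈) = Pointwise-column⁻ js fs≤gs i∈

    Pointwise-column⁺ : ∀ {f g : Fin N → ℕ} js → (∀ {i} → i ∈ js → f i ≤ g i) → Pointwise _≤_ (map f js) (map g js)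
    Pointwise-column⁺ [] _ = []
    Pointwise-column⁺ (_ ∷ js) f≤g = f≤g (here refl) ∷ Pointwise-column⁺ js (f≤g ∘ there)

    map-∸ : ∀ {f g : Fin N → ℕ} js → map (λ i → f i ∸ g i) js ≡ zipWith _∸_ (map f js) (map g js)
    map-∸ [] = refl
    map-∸ (_ ∷ js) = cong (_ ∷_) (map-∸ js)

    zipWith-map : ∀ {A : Set} (h : ℕ → A → ℕ) (f : ℕ → A) vs → zipWith h vs (map f vs) ≡ map (λ u → h u (f u)) vs
    zipWith-map h f [] = refl
    zipWith-map h f (_ ∷ vs) = cong (_ ∷_) (zipWith-map h f vs)

    extensions-supported : ∀ {α αs m v} → v ∈ supportedVecs α → SupportedOn m →
      (∀ m′ → SupportedOn m′ → tupleCount αs m′ ≡ columnCount αs m′) →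
      extensions α αs m v ≡ completionCount m αs (exponentMatrix α v)
    extensions-supported {α} {αs} {m} {v} v∈ supp ih =
      trans (split (all? (λ u → Pointwise.decidable _≤?_ (column E u) (column m u)) us))
        (sym (cong product (zipWith-map (λ u r → completions (width u) (column m u) αs u r) (column E) us)))
      where
      E = exponents (factors (α , v))
      completion : ℕ → ℕ
      completion u = completions (width u) (column m u) αs u (column E u)
      split : Dec (All (λ u → Pointwise _≤_ (column E u) (column m u)) us) → extensions α αs m v ≡ product (map completion us)
      split (no E≰m) with find (¬All⇒Any¬ (λ u → Pointwise.decidable _≤?_ (column E u) (column m u)) us E≰m)
      ... | u , u∈ , ≰ = trans
        (Nat.∑-ε (tuples αs) (λ {ts} _ → indicator-no _ (λ agree → ≰ (Pointwise-column⁺ (J u)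
          (λ {i} _ → subst (E u i ≤_) (All.lookup agree u∈ i) (m≤m+n _ _))))))
        (sym (Nat.∏-0 completion us u∈ (completions-≰ ≰)))
      split (yes E≤m) = begin
        extensions α αs m v
          ≡⟨ Nat.∑-cong (tuples αs) (λ {ts} _ → indicator-cong _ (agree? us (tupleExponents ts) m∸E)
               (All.map (λ E+ts≡m i → trans (sym (m+n∸m≡n (E _ i) _)) (cong (_∸ E _ i) (E+ts≡m i))))
               (λ ts≡m∸E → All.tabulate (λ {u} u∈ i →
                 trans (cong (E u i +_) (All.lookup ts≡m∸E u∈ i)) (m+[n∸m]≡n (E≤m′ u∈ i))))) ⟩
        tupleCount αs m∸E
          ≡⟨ ih m∸E (λ u∈ i m∸E≢0 → supp u∈ i (λ m≡0 → m∸E≢0 (trans (cong (_∸ E _ i) m≡0) (0∸n≡0 (E _ i))))) ⟩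
        columnCount αs m∸E
          ≡⟨ cong product (map-cong-local {xs = us} (All.tabulate (λ {u} u∈ →
               trans (cong (λ c → matrixCount (width u) c αs u) (map-∸ (J u))) (sym (completions-≤ (All.lookup E≤m u∈)))))) ⟩
        product (map completion us) ∎
        where
        m∸E : Exponents
        m∸E u i = m u i ∸ E u i
        E≤m′ : ∀ {u} → u ∈ us → ∀ i → E u i ≤ m u i
        E≤m′ {u} u∈ i with i ∈? J u
        ... | yes i∈ = Pointwise-column⁻ (J u) (All.lookup E≤m u∈) i∈
        ... | no i∉ = subst (_≤ m u i) (sym (exponents-outside (proj₂ (∈-supportedVecs⁻ {α} v∈)) i∉)) z≤n

    ∑-supportedVecs : ∀ {α} αs m → Bounded α →
      sum (map (completionCount m αs ∘ exponentMatrix α) (supportedVecs α)) ≡ columnCount (α ∷ αs) m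
    ∑-supportedVecs {α} αs m bα@(sp , _) = by-fit (all? (λ u → length (restrict α u) ≤? width u) us)
      where
      by-fit : Dec (All (λ u → Fits (width u) u α) us) →
        sum (map (completionCount m αs ∘ exponentMatrix α) (supportedVecs α)) ≡ columnCount (α ∷ αs) m
      by-fit (no ¬fits) with find (¬All⇒Any¬ (λ u → length (restrict α u) ≤? width u) us ¬fits)
      ... | u , u∈ , ¬fit = trans
        (Nat.∑-ε (supportedVecs α) (λ v∈ → ⊥-elim (¬fit (proj₂ (supportedVecs-column-↭ {α} sp v∈ u)))))
        (sym (Nat.∏-0 _ us u∈ (matrixCount-¬fits {width u} {column m u} {α ∷ αs} {u} (¬fit ∘ All.head))))
      by-fit (yes fits) = begin
        sum (map (completionCount m αs ∘ exponentMatrix α) (supportedVecs α))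
          ≡⟨ Nat.∑-bijection (exponentMatrix α) (completionCount m αs)
               (Unique.filter⁺ _ (Unique.filter⁺ (admissible? α) (allVecs-unique R N (length α))))
               (choices-unique (All.map⁺ {xs = us} (All.tabulate (λ {u} _ → rearrangements-unique (pad (width u) (restrict α u))))))
               (exponentMatrix∈rowChoices sp) (exponentMatrix-injective bα)
               (exponentMatrix-onto bα fits) ⟩
        sum (map (completionCount m αs) (rowChoices α))
          ≡⟨ Nat.∏-∑-choices us (λ u → rowsOf (width u) u α) (λ u r → completions (width u) (column m u) αs u r) ⟨
        product (map (λ u → sum (map (completions (width u) (column m u) αs u) (rowsOf (width u) u α))) us)
          ≡⟨ cong product (map-cong-local {xs = us} (All.tabulate (λ {u} u∈ →
               sym (matrixCount-∷ {width u} {column m u} {α} {αs} {u} (All.lookup fits u∈) (length-map (m u) (J u)))))) ⟩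
        columnCount (α ∷ αs) m ∎

    tupleCount≡columnCount : ∀ {αs} → All Bounded αs → ∀ m → SupportedOn m → tupleCount αs m ≡ columnCount αs m
    tupleCount≡columnCount [] = tupleCount-[]
    tupleCount≡columnCount {α ∷ αs} (bα ∷ bαs) m supp = begin
      tupleCount (α ∷ αs) m
        ≡⟨ tupleCount-∷ α αs m ⟩
      sum (map (extensions α αs m) (admissibleVecs α))
        ≡⟨ Nat.∑-filter _ (extensions α αs m) (admissibleVecs α) (extensions-outside {α} {αs} bα supp) ⟩
      sum (map (extensions α αs m) (supportedVecs α))
        ≡⟨ Nat.∑-cong (supportedVecs α) (λ v∈ → extensions-supported {α} {αs} v∈ supp (tupleCount≡columnCount bαs)) ⟩
      sum (map (completionCount m αs ∘ exponentMatrix α) (supportedVecs α))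
        ≡⟨ ∑-supportedVecs αs m bα ⟩
      columnCount (α ∷ αs) m ∎

-- e ↦ ∏_{u ∈ us} ∏ᵢ g u i (e u i), where g u i m is the image of x_{u,i}^m
module ExponentHom {a ℓ : Level} (M : CommutativeMonoid a ℓ) (N : ℕ)
  (g : ℕ → Fin N → ℕ → CommutativeMonoid.Carrier M)
  (g-+ : ∀ u i m n → CommutativeMonoid._≈_ M (g u i (m ℕ.+ n)) (CommutativeMonoid._∙_ M (g u i m) (g u i n)))
  (g-0 : ∀ u i → CommutativeMonoid._≈_ M (g u i 0) (CommutativeMonoid.ε M))
  (us : List ℕ) (us-unique : Unique us) where

  open import Data.Nat using (_+_)
  open import Data.Product using (proj₁; proj₂)
  open import Data.List using ([]; _∷_; allFin)
  open import Data.List.Relation.Unary.All as All using (All; []; _∷_)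
  open import Data.List.Relation.Unary.Unique.Propositional.Properties using (allFin⁺)
  open import Data.List.Membership.Propositional using (_∈_)
  open import Data.List.Membership.Propositional.Properties using (∈-allFin)
  open import Function using (_∘_)
  open import Relation.Binary.PropositionalEquality as ≡ using (_≡_)
  open BigOperators using (module BigOperator)
  open Factors N

  open CommutativeMonoid M
  open BigOperator M
  open import Relation.Binary.Reasoning.Setoid setoid

  hom : Exponents → Carrier
  hom e = ∑ (λ u → ∑ (λ i → g u i (e u i)) (allFin N)) us

  hom-cong : ∀ {e e′} → AgreeOn us e e′ → hom e ≈ hom e′
  hom-cong agree = ∑-cong us (λ {u} u∈ → ∑-cong (allFin N) (λ {i} _ → reflexive (≡.cong (g u i) (All.lookup agree u∈ i))))

  hom-+ : ∀ e e′ → hom (λ u i → e u i + e′ u i) ≈ hom e ∙ hom e′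
  hom-+ e e′ = begin
    ∑ (λ u → ∑ (λ i → g u i (e u i + e′ u i)) (allFin N)) us
      ≈⟨ ∑-cong us (λ {u} _ → ∑-cong (allFin N) (λ {i} _ → g-+ u i (e u i) (e′ u i))) ⟩
    ∑ (λ u → ∑ (λ i → g u i (e u i) ∙ g u i (e′ u i)) (allFin N)) us
      ≈⟨ ∑-cong us (λ {u} _ → ∑-∙ (λ i → g u i (e u i)) (λ i → g u i (e′ u i)) (allFin N)) ⟩
    ∑ (λ u → ∑ (λ i → g u i (e u i)) (allFin N) ∙ ∑ (λ i → g u i (e′ u i)) (allFin N)) us
      ≈⟨ ∑-∙ _ _ us ⟩
    hom e ∙ hom e′ ∎

  hom-0 : hom (λ _ _ → 0) ≈ ε
  hom-0 = ∑-ε us (λ {u} _ → ∑-ε (allFin N) (λ {i} _ → g-0 u i))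

  hom-exponent : ∀ {a} → degree a ∈ us → hom (exponent a) ≈ g (degree a) (index a) (power a)
  hom-exponent {a} a∈ = begin
    hom (exponent a)
      ≈⟨ ∑-single _ us-unique a∈ (λ {u} _ u≢ → ∑-ε (allFin N) (λ {i} _ →
           trans (reflexive (≡.cong (g u i) (exponent-≢ a (u≢ ∘ ≡.sym ∘ ≡.cong proj₁)))) (g-0 u i))) ⟩
    ∑ (λ i → g (degree a) i (exponent a (degree a) i)) (allFin N)
      ≈⟨ ∑-single _ (allFin⁺ N) (∈-allFin (index a)) (λ {i} _ i≢ →
           trans (reflexive (≡.cong (g (degree a) i) (exponent-≢ a (i≢ ∘ ≡.sym ∘ ≡.cong proj₂)))) (g-0 (degree a) i)) ⟩
    g (degree a) (index a) (exponent a (degree a) (index a))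
      ≡⟨ ≡.cong (g (degree a) (index a)) (exponent-var a) ⟩
    g (degree a) (index a) (power a) ∎

  hom-exponents : ∀ {L} → DegreesIn us L → hom (exponents L) ≈ ∑ (λ a → g (degree a) (index a) (power a)) L
  hom-exponents {[]} [] = hom-0
  hom-exponents {a ∷ L} (a∈ ∷ L∈) = trans (hom-+ (exponent a) (exponents L)) (∙-cong (hom-exponent a∈) (hom-exponents L∈))

  hom-tupleExponents : ∀ {ts} → All (DegreesIn us ∘ factors) ts →
    hom (tupleExponents ts) ≈ ∑ (λ t → ∑ (λ a → g (degree a) (index a) (power a)) (factors t)) ts
  hom-tupleExponents {[]} [] = hom-0
  hom-tupleExponents {t ∷ ts} (t∈ ∷ ts∈) = trans (hom-+ (exponents (factors t)) (tupleExponents ts))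
    (∙-cong (hom-exponents t∈) (hom-tupleExponents ts∈))

module Expansion {c ℓ} (R : CommutativeSemiring c ℓ) (N : ℕ) (x : ℕ → Fin N → CommutativeSemiring.Carrier R) where

  open import Data.Nat using (suc; _+_; _*_; _≤_; _≟_)
  open import Data.Nat.Properties using (+-0-commutativeMonoid; *-distribˡ-+; *-zeroʳ; ≤-trans; m≤m+n; ≤-reflexive)
  open import Data.Nat.ListAction using (sum; product)
  open import Data.Product using (_×_; _,_; proj₁; proj₂; ∃-syntax)
  open import Data.Product.Properties.WithK using (,-injectiveʳ)
  open import Data.List using (List; []; _∷_; map; length; lookup; allFin; tabulate; concatMap; applyUpTo)
  open import Data.List.Properties using (map-cong-local; map-∘; map-tabulate; length-map)
  open import Data.List.Relation.Unary.All as All using (All; []; _∷_)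
  import Data.List.Relation.Unary.All.Properties as All
  import Data.List.Relation.Unary.AllPairs as AllPairs
  import Data.List.Relation.Unary.AllPairs.Properties as AllPairs
  open import Data.List.Relation.Unary.Unique.Propositional using (Unique)
  import Data.List.Relation.Unary.Unique.Propositional.Properties as Unique
  open import Data.List.Relation.Binary.Pointwise using (Pointwise; []; _∷_)
  open import Data.List.Membership.Propositional using (_∈_; find; lose)
  open import Data.List.Membership.Propositional.Properties using (∈-map⁺; ∈-map⁻; ∈-concatMap⁺; ∈-concatMap⁻; ∈-filter⁺;
    ∈-filter⁻; ∈-allFin)
  open import Data.Vec as Vec using (Vec)
  open import Function using (_∘_; id)
  open import Relation.Binary.PropositionalEquality as ≡ using (_≡_; _≢_; refl; cong; cong₂)
  open import Data.Empty using (⊥)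
  open BigOperators
  open Enumerations
  open Stacks using (deg≤size)
  open Factors N
  open Terms R N
  open Counting R N
  open Matrices using (matrixCount; sCount≡matrixCount)

  open CommutativeSemiring R using (Carrier; _≈_; 1#; *-commutativeMonoid; setoid; reflexive; trans; sym; *-congˡ;
    +-identityʳ) renaming (refl to ≈-refl; _*_ to _⊗_)
  open Eval R using (sumR; prodR; pow; natMul; M; allVecs; admissible?)
  open SemiringSums R

  factorValue : Factor → Carrier
  factorValue a = pow (x (degree a) (index a)) (power a)

  -- literally the summand of M τ at v, so that M τ unfolds to a sum of termValue
  termValue : Term → Carrier
  termValue (τ , v) = prodR (map (λ k → pow (x (deg (lookup τ k)) (Vec.lookup v k)) (mult (lookup τ k))) (allFin (length τ)))

  tupleValue : List Term → Carrier
  tupleValue ts = prodR (map termValue ts)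

  termValue-factors : ∀ t → termValue t ≡ prodR (map factorValue (factors t))
  termValue-factors t = cong prodR (≡.trans (map-tabulate id _)
    (≡.trans (≡.sym (map-tabulate (factorAt t) factorValue)) (cong (map factorValue) (tabulate-factorAt t))))

  M-product : ∀ βs → prodR (map (M N x) βs) ≈ sumR (map tupleValue (tuples βs))
  M-product [] = sym (+-identityʳ 1#)
  M-product (β ∷ βs) = trans (*-congˡ (M-product βs))
    (∑-*-∑ (λ v ts → (β , v) ∷ ts) (termValue ∘ (β ,_)) tupleValue tupleValue (admissibleVecs β) (tuples βs)
      (λ _ _ → ≈-refl))

  variablePower : ℕ → Fin N → ℕ → Carrier
  variablePower u i = pow (x u i)

  variablePower-+ : ∀ u i m n → variablePower u i (m + n) ≈ variablePower u i m ⊗ variablePower u i n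
  variablePower-+ u i = pow-+ (x u i)

  variablePower-0 : ∀ u i → variablePower u i 0 ≈ 1#
  variablePower-0 _ _ = ≈-refl

  degreeWeight : ℕ → Fin N → ℕ → ℕ
  degreeWeight u _ m = u * m

  degreeWeight-+ : ∀ u i m n → degreeWeight u i (m + n) ≡ degreeWeight u i m + degreeWeight u i n
  degreeWeight-+ u _ = *-distribˡ-+ u

  degreeWeight-0 : ∀ u i → degreeWeight u i 0 ≡ 0
  degreeWeight-0 u _ = *-zeroʳ u

  module Regrouping (αs : List StackPartition) (stackPartitions-αs : All IsStackPartition αs) where

    n : ℕ
    n = sum (map size αs)

    -- calS takes the product over the degrees 1, …, |τ| + n, and |τ| = n below
    K : ℕ
    K = n + n

    us : List ℕ
    us = range1 K

    terms : List Term
    terms = concatMap (λ τ → map (τ ,_) (admissibleVecs τ)) (stackPartitions n)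

    Agrees : List Term → Term → Set
    Agrees ts t = AgreeOn us (tupleExponents ts) (exponents (factors t))

    module Value = ExponentHom *-commutativeMonoid N variablePower variablePower-+ variablePower-0 us (range1-unique K)
    module Weight = ExponentHom +-0-commutativeMonoid N degreeWeight degreeWeight-+ degreeWeight-0 us (range1-unique K)

    degrees-bounded : ∀ {τ} → All PositiveStack τ → size τ ≤ n → All (λ s → deg s ∈ us) τ
    degrees-bounded {τ} pos τ≤n = All.tabulate (λ {s} s∈ → let ps = All.lookup pos s∈ in
      ∈-range1⁺ (proj₁ ps) (≤-trans (deg≤size ps s∈) (≤-trans τ≤n (m≤m+n n n))))

    αs-bounded : All (λ α → IsStackPartition α × All (λ s → deg s ∈ us) α) αs
    αs-bounded = All.tabulate (λ α∈ → let sp = All.lookup stackPartitions-αs α∈ in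
      sp , degrees-bounded (proj₁ sp) (≤-∑ size α∈))

    ∈-terms⁻ : ∀ {t} → t ∈ terms → proj₁ t ⊩ n × ValidTerm t
    ∈-terms⁻ t∈ with find (∈-concatMap⁻ (λ τ → map (τ ,_) (admissibleVecs τ)) {xs = stackPartitions n} t∈)
    ... | τ , τ∈ , t∈′ with ∈-map⁻ (τ ,_) t∈′
    ...   | v , v∈ , refl = ∈-stackPartitions⁻ {n} τ∈ , proj₁ (∈-stackPartitions⁻ {n} τ∈) ,
                            proj₂ (∈-filter⁻ (admissible? τ) {xs = allVecs N (length τ)} v∈)

    ∈-terms⁺ : ∀ {t} → proj₁ t ⊩ n → ValidTerm t → t ∈ terms
    ∈-terms⁺ {τ , v} τ⊩n (_ , adm) = ∈-concatMap⁺ (λ τ → map (τ ,_) (admissibleVecs τ))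
      (lose (∈-stackPartitions⁺ {n} τ⊩n) (∈-map⁺ (τ ,_) (∈-filter⁺ (admissible? τ) (∈-allVecs R N v) adm)))

    terms-unique : Unique terms
    terms-unique = Unique.concat⁺ (All.map⁺ (All.tabulate (λ {τ} _ →
        Unique.map⁺ ,-injectiveʳ (Unique.filter⁺ (admissible? τ) (allVecs-unique R N (length τ))))))
      (AllPairs.map⁺ (AllPairs.map disjoint (stackPartitions-unique n)))
      where
      disjoint : ∀ {τ τ′} → τ ≢ τ′ → ∀ {t} →
        t ∈ map (τ ,_) (admissibleVecs τ) × t ∈ map (τ′ ,_) (admissibleVecs τ′) → ⊥
      disjoint τ≢τ′ (t∈ , t∈′) with ∈-map⁻ _ t∈ | ∈-map⁻ _ t∈′
      ... | _ , _ , refl | _ , _ , eq = τ≢τ′ (cong proj₁ eq)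

    terms-normal : ∀ {t} → t ∈ terms → Normal (factors t) × DegreesIn us (factors t)
    terms-normal {t} t∈ with ∈-terms⁻ t∈
    ... | (((pos , _) , |τ|≡n) , valid) = valid⇒normal t valid ,
      degreesIn-factors t (degrees-bounded pos (≤-reflexive |τ|≡n))

    tuples-normal : ∀ {ts} → ts ∈ tuples αs → All (λ t → Normal (factors t) × DegreesIn us (factors t)) ts
    tuples-normal {ts} ts∈ = normal αs-bounded (proj₁ (∈-tuples⁻ αs ts∈)) (proj₂ (∈-tuples⁻ αs ts∈))
      where
      normal : ∀ {βs ts} → All (λ α → IsStackPartition α × All (λ s → deg s ∈ us) α) βs → map proj₁ ts ≡ βs →
        All (λ t → proj₂ t ∈ admissibleVecs (proj₁ t)) ts → All (λ t → Normal (factors t) × DegreesIn us (factors t)) ts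
      normal {ts = []} [] refl [] = []
      normal {ts = t ∷ ts} ((sp , degs) ∷ bs) refl (v∈ ∷ vs∈) =
        (admissibleVecs-normal sp v∈ , degreesIn-factors t degs) ∷ normal bs refl vs∈

    normalForm-unique : ∀ {ts t t′} → t ∈ terms → t′ ∈ terms → Agrees ts t → Agrees ts t′ → t ≡ t′
    normalForm-unique t∈ t′∈ agree agree′ = factors-injective (normal-agree⇒≡
      (proj₁ (terms-normal t∈)) (proj₁ (terms-normal t′∈)) (proj₂ (terms-normal t∈)) (proj₂ (terms-normal t′∈))
      (All.zipWith (λ (e , e′) i → ≡.trans (≡.sym (e i)) (e′ i)) (agree , agree′)))

    weight-factors : ∀ t → sum (map (λ a → degree a * power a) (factors t)) ≡ size (proj₁ t)
    weight-factors t = cong sum (≡.trans (map-∘ (factors t)) (cong (map (λ s → deg s * mult s)) (stacks-factors t)))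

    normalForm-exists : ∀ {ts} → ts ∈ tuples αs → ∃[ t ] (t ∈ terms × Agrees ts t)
    normalForm-exists {ts} ts∈ = t , ∈-terms⁺ (proj₁ valid , size≡n) valid , agree
      where
      open FromRows (λ _ → allFin N) (λ _ → Unique.allFin⁺ N) (range1-unique K) (All.tabulate ∈-range1⁻)
      e = tupleExponents ts
      rows : List ℕ → List (List ℕ)
      rows = map (λ u → map (e u) (allFin N))
      lengths : ∀ vs → Pointwise (λ u r → length r ≡ length (allFin N)) vs (rows vs)
      lengths [] = []
      lengths (u ∷ vs) = length-map (e u) (allFin N) ∷ lengths vs
      t = rowsTerm (rows us)
      valid = rowsTerm-valid (rows us)
      agree : AgreeOn us e (exponents (factors t))
      agree = All.tabulate (λ u∈ i → ≡.sym (map-≡⇒≡ (map-≡⇒≡ (exponents-rowsTerm (lengths us)) u∈) (∈-allFin i)))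
      size≡n : size (proj₁ t) ≡ n
      size≡n = begin
        size (proj₁ t)                                 ≡⟨ weight-factors t ⟨
        sum (map (λ a → degree a * power a) (factors t)) ≡⟨ Weight.hom-exponents (All.map proj₁ (rowsTerm-RowsFactor (rows us))) ⟨
        Weight.hom (exponents (factors t))             ≡⟨ Weight.hom-cong agree ⟨
        Weight.hom e                                   ≡⟨ Weight.hom-tupleExponents (All.map proj₂ (tuples-normal ts∈)) ⟩
        sum (map (λ t → sum (map (λ a → degree a * power a) (factors t))) ts)
                                                       ≡⟨ Nat.∑-cong ts (λ {t} _ → weight-factors t) ⟩
        sum (map (size ∘ proj₁) ts)                    ≡⟨ cong sum (map-∘ ts) ⟩
        sum (map size (map proj₁ ts))                  ≡⟨ cong (sum ∘ map size) (proj₁ (∈-tuples⁻ αs ts∈)) ⟩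
        n                                              ∎
        where open ≡.≡-Reasoning

    tupleValue-agrees : ∀ {ts t} → ts ∈ tuples αs → t ∈ terms → Agrees ts t → tupleValue ts ≈ termValue t
    tupleValue-agrees {ts} {t} ts∈ t∈ agree = begin
      tupleValue ts                                          ≈⟨ ∏-cong ts (λ {t} _ → reflexive (termValue-factors t)) ⟩
      ∏ (λ t → ∏ factorValue (factors t)) ts                 ≈⟨ Value.hom-tupleExponents (All.map proj₂ (tuples-normal ts∈)) ⟨
      Value.hom (tupleExponents ts)                          ≈⟨ Value.hom-cong agree ⟩
      Value.hom (exponents (factors t))                      ≈⟨ Value.hom-exponents (proj₂ (terms-normal t∈)) ⟩
      ∏ factorValue (factors t)                              ≡⟨ termValue-factors t ⟨
      termValue t                                            ∎
      where open import Relation.Binary.Reasoning.Setoid setoid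

    -- the number of tuples whose product is the monomial t
    multiplicity : Term → ℕ
    multiplicity t = sum (map (λ ts → indicator (agree? us (tupleExponents ts) (exponents (factors t)))) (tuples αs))

    multiplicity≡calS : ∀ {t} → t ∈ terms → multiplicity t ≡ calS (proj₁ t) αs
    multiplicity≡calS {t@(τ , v)} t∈ = begin
      TC.tupleCount αs m
        ≡⟨ TC.tupleCount≡columnCount αs-bounded m supported ⟩
      TC.columnCount αs m
        ≡⟨ cong product (map-cong-local {xs = us} (All.tabulate (λ {u} _ → ≡.trans
             (cong₂ (λ ℓ c → matrixCount ℓ c αs u) (width≡ u) (column≡ u)) (≡.sym (sCount≡matrixCount τ αs u))))) ⟩
      product (map (sCount τ αs) us)
        ≡⟨ cong product (applyUpTo-∘ (sCount τ αs) suc K) ⟨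
      product (applyUpTo (sCount τ αs ∘ suc) (n + n))
        ≡⟨ cong (λ k → product (applyUpTo (sCount τ αs ∘ suc) (k + n))) (proj₂ (proj₁ (∈-terms⁻ t∈))) ⟨
      calS τ αs ∎
      where
      open ≡.≡-Reasoning
      nf = proj₁ (terms-normal t∈)
      m = exponents (factors t)
      J : ℕ → List (Fin N)
      J u = map index (ofDegree u (factors t))
      module TC = TupleCount K J (λ u → indices-ofDegree-unique u (Normal.distinct nf))
      supported : TC.SupportedOn m
      supported {u} _ i m≢0 with exponents≢0 (factors t) m≢0
      ... | a , a∈ , refl = ∈-map⁺ index (∈-filter⁺ (λ a → degree a ≟ u) a∈ refl)
      width≡ : ∀ u → length (J u) ≡ length (restrict τ u)
      width≡ u = ≡.trans (length-map index (ofDegree u (factors t)))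
        (≡.trans (≡.sym (length-map power (ofDegree u (factors t)))) (cong length (powers-ofDegree t u)))
      column≡ : ∀ u → map (m u) (J u) ≡ restrict τ u
      column≡ u = ≡.trans (≡.sym (map-∘ _)) (≡.trans (map-cong-local (All.tabulate at-index)) (powers-ofDegree t u))
        where
        at-index : ∀ {a} → a ∈ ofDegree u (factors t) → m u (index a) ≡ power a
        at-index a∈ with ∈-filter⁻ (λ a → degree a ≟ u) {xs = factors t} a∈
        ... | a∈L , refl = exponents-var (Normal.distinct nf) a∈L

    regroup : sumR (map tupleValue (tuples αs)) ≈ sumR (map (λ t → natMul (calS (proj₁ t) αs) (termValue t)) terms)
    regroup = trans (∑-fibres Agrees (λ ts t → agree? us (tupleExponents ts) (exponents (factors t))) tupleValue termValue
        (tuples αs) terms unique-normalForm tupleValue-agrees)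
      (∑-cong terms (λ {t} t∈ → reflexive (cong (λ k → natMul k (termValue t)) (multiplicity≡calS t∈))))
      where
      unique-normalForm : ∀ {ts} → ts ∈ tuples αs →
        sum (map (λ t → indicator (agree? us (tupleExponents ts) (exponents (factors t)))) terms) ≡ 1
      unique-normalForm {ts} ts∈ with normalForm-exists ts∈
      ... | t , t∈ , agree = ∑indicator≡1 (λ t → agree? us (tupleExponents ts) (exponents (factors t))) terms-unique t∈ agree
        (λ t′∈ agree′ → normalForm-unique {ts} t′∈ t∈ agree′ agree)

    ∑-calS : sumR (map (λ τ → natMul (calS τ αs) (M N x τ)) (stackPartitions n)) ≈
             sumR (map (λ t → natMul (calS (proj₁ t) αs) (termValue t)) terms)
    ∑-calS = trans
      (∑-cong (stackPartitions n) (λ {τ} _ → trans (natMul-∑ʳ (calS τ αs) (termValue ∘ (τ ,_)) (admissibleVecs τ))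
        (reflexive (cong sumR (map-∘ (admissibleVecs τ))))))
      (sym (∑-concatMap (λ t → natMul (calS (proj₁ t) αs) (termValue t)) (λ τ → map (τ ,_) (admissibleVecs τ))
        (stackPartitions n)))

mainTheorem15 : ∀ {c ℓ} (R : CommutativeSemiring c ℓ) (N : ℕ)
    (x : ℕ → Fin N → CommutativeSemiring.Carrier R)
    (αs : List StackPartition) → All IsStackPartition αs →
    CommutativeSemiring._≈_ R
      (Eval.prodR R (map (Eval.M R N x) αs))
      (Eval.sumR R (map (λ τ → Eval.natMul R (calS τ αs) (Eval.M R N x τ))
                        (stackPartitions (sum (map size αs)))))
mainTheorem15 R N x αs αs-partitions = begin
  prodR (map (M N x) αs)                                              ≈⟨ M-product αs ⟩
  sumR (map tupleValue (tuples αs))                                   ≈⟨ regroup ⟩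
  sumR (map (λ t → natMul (calS (proj₁ t) αs) (termValue t)) terms)   ≈⟨ ∑-calS ⟨
  sumR (map (λ τ → natMul (calS τ αs) (M N x τ)) (stackPartitions n)) ∎
  where
  open Eval R using (prodR; sumR; natMul; M)
  open Expansion R N x
  open Regrouping αs αs-partitions
  open import Relation.Binary.Reasoning.Setoid (CommutativeSemiring.setoid R)
  open Counting R N using (tuples)
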